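{- Let $p$ be an odd prime, $H$ a finite vector space over $\mathbb{F}_p$, and $Q=(q_1,\dots,q_d)$ a $d$-tuple of quadratic polynomials on $H$ of rank at least $R$; write $Q_0$ for the $d$-tuple of homogeneous quadratic parts of the $q_i$. Then there is an absolute constant $C$ such that for any $A\subset Q_0^{ -1}(0)$, $$\Big|\sum_{x,y\in H}1_{Q^{ -1}(0)}(x)1_{Q^{ -1}(0)}(x+y)1_{Q^{ -1}(0)}(x+2y)1_A(y)-|H||A|p^{ -2d}\Big|\le C|H|^2p^{ -R/2}.$$
   Context: For a tuple $P=(p_1,\dots,p_d)$ of maps $H\to\mathbb{F}_p$, $P^{ -1}(0)=\{x:p_1(x)=\dots=p_d(x)=0\}$. A quadratic polynomial is $x\mapsto b(x,x)+\ell(x)+c$ with homogeneous quadratic part $x\mapsto b(x,x)$, whose rank is the rank of $\frac12(b(x,y)+b(y,x))$; $Q$ has rank at least $R$ if every nontrivial $\mathbb{F}_p$-linear combination of the $q_i$ has homogeneous quadratic part of rank at least $R$. -}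

module Defs where

open import Data.Nat using (ℕ; zero; suc; _+_; _*_; NonZero)
open import Data.Nat.DivMod using (_mod_)
open import Data.Fin using (Fin; toℕ)
open import Data.Fin.Properties using () renaming (_≟_ to _≟F_)
open import Data.List using (List; map; allFin)
open import Data.Nat.ListAction using (sum)
open import Data.Bool using (Bool; true; false; if_then_else_; _∧_)
open import Data.Product using (Σ; _×_; _,_; ∃)
open import Relation.Binary.PropositionalEquality using (_≡_; _≢_)
open import Relation.Nullary.Decidable using (⌊_⌋)

module _ (p : ℕ) .{{_ : NonZero p}} where

  F : Set
  F = Fin p

  0F : F
  0F = 0 mod p

  _+F_ : F → F → F
  a +F b = (toℕ a + toℕ b) mod p

  _*F_ : F → F → F
  a *F b = (toℕ a * toℕ b) mod p

  -- 1/2 in F_p (p odd): (p+1)/2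
  half : F
  half = ((suc p) Data.Nat./ 2) mod p

  ΣF : (k : ℕ) → (Fin k → F) → F
  ΣF zero f = 0F
  ΣF (suc k) f = f Data.Fin.zero +F ΣF k (λ i → f (Data.Fin.suc i))

  -- H = F_p^n (any finite F_p-vector space is isomorphic to one of these)
  Vec : ℕ → Set
  Vec n = Fin n → F

  _+V_ : ∀ {n} → Vec n → Vec n → Vec n
  (x +V y) i = x i +F y i

  record QuadPoly (n : ℕ) : Set where
    field
      B : Fin n → Fin n → F
      ℓ : Fin n → F
      c : F

  bform : ∀ {n} → (Fin n → Fin n → F) → Vec n → Vec n → F
  bform {n} M x y = ΣF n (λ i → ΣF n (λ j → (M i j *F x i) *F y j))

  evalQ : ∀ {n} → QuadPoly n → Vec n → F
  evalQ {n} q x = (bform (QuadPoly.B q) x x +F ΣF n (λ i → QuadPoly.ℓ q i *F x i)) +F QuadPoly.c q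

  evalQ0 : ∀ {n} → QuadPoly n → Vec n → F
  evalQ0 q x = bform (QuadPoly.B q) x x

  symm : ∀ {n} → (Fin n → Fin n → F) → Fin n → Fin n → F
  symm M i j = half *F (M i j +F M j i)

  ColsIndep : ∀ {n r} → (Fin n → Fin n → F) → (Fin r → Fin n) → Set
  ColsIndep {n} {r} M f =
    (λc : Fin r → F) → (∀ i → ΣF r (λ k → λc k *F M i (f k)) ≡ 0F) → ∀ k → λc k ≡ 0F

  RankAtLeast : ∀ {n} → (Fin n → Fin n → F) → ℕ → Set
  RankAtLeast {n} M R = Σ (Fin R → Fin n) (λ f → ColsIndep M f)

  combB : ∀ {n d} → (Fin d → QuadPoly n) → (Fin d → F) → Fin n → Fin n → F
  combB {n} {d} Q λc a b = ΣF d (λ i → λc i *F QuadPoly.B (Q i) a b)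

  QRankAtLeast : ∀ {n d} → (Fin d → QuadPoly n) → ℕ → Set
  QRankAtLeast {n} {d} Q R =
    (λc : Fin d → F) → (∃ λ i → λc i ≢ 0F) → RankAtLeast (symm (combB Q λc)) R

  isZero : F → Bool
  isZero a = ⌊ a ≟F 0F ⌋

  allB : (k : ℕ) → (Fin k → Bool) → Bool
  allB zero f = true
  allB (suc k) f = f Data.Fin.zero ∧ allB k (λ i → f (Data.Fin.suc i))

  inZ : ∀ {n d} → (Fin d → QuadPoly n) → Vec n → Bool
  inZ {d = d} Q x = allB d (λ i → isZero (evalQ (Q i) x))

  inZ0 : ∀ {n d} → (Fin d → QuadPoly n) → Vec n → Bool
  inZ0 {d = d} Q x = allB d (λ i → isZero (evalQ0 (Q i) x))

  sumH : (n : ℕ) → (Vec n → ℕ) → ℕ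
  sumH zero g = g (λ ())
  sumH (suc n) g = sum (map (λ a → sumH n (λ v → g (λ { Data.Fin.zero → a ; (Data.Fin.suc i) → v i }))) (allFin p))

  𝟙 : Bool → ℕ
  𝟙 b = if b then 1 else 0

  count : ∀ {n d} → (Fin d → QuadPoly n) → (Vec n → Bool) → ℕ
  count {n} Q A = sumH n (λ x → sumH n (λ y →
    𝟙 (inZ Q x) * 𝟙 (inZ Q (x +V y)) * 𝟙 (inZ Q ((x +V y) +V y)) * 𝟙 (A y)))

  card : ∀ {n} → (Vec n → Bool) → ℕ
  card {n} A = sumH n (λ y → 𝟙 (A y))

-- Let S(c₁, c₂) count the pairs (x, y) with y ∈ A, Q(x) = c₁ and Q(x + y) = c₂. Since
-- Q(x + 2y) + Q(x) = 2 Q(x + y) + 2 Q₀(y) and Q₀ vanishes on A, the sum in the statement is S(0, 0).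
-- The p^{2d} values S(c) add up to |H||A|, so (S(0,0) p^{2d} − |H||A|)² is at most the variance
-- Σ_c (S(c) p^{2d} − |H||A|)² = p^{4d} Σ_c S(c)² − p^{2d} |H|²|A|². The second moment Σ_c S(c)² counts
-- (x, x', y, y') with Q(x) = Q(x') and Q(x + y) = Q(x' + y'); for fixed y, y' and h = x' − x these are
-- 2d affine equations in x, and double counting bounds their solutions by the number of linear
-- relations (κ, μ) between the equations. Such a relation forces one linear equation in the polarised
-- form of κ + μ (applied to h) or, when κ + μ = 0, of μ (applied to y'); by the rank hypothesis each
-- costs a factor p^R, and the trivial relation κ = μ = 0 gives exactly the main term p^{2d}|H|²|A|².

module Submission where

open import Defs
open import Level using (0ℓ)
open import Data.Nat as ℕ using (ℕ; zero; suc; NonZero; _+_; _*_; _∸_; _^_; _%_; _≤_; _<_; z≤n; s≤s)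
import Data.Nat.Properties as ℕₚ
import Algebra.Properties.CommutativeSemigroup as CommutativeSemigroupProperties
open CommutativeSemigroupProperties ℕₚ.+-commutativeSemigroup using () renaming (interchange to +-interchange)
open import Data.Nat.DivMod
  using (_mod_; _/_; m%n<n; m%n%n≡m%n; m<n⇒m%n≡m; n%n≡0; m*n%n≡0; %-distribˡ-+; %-distribˡ-*;
         [m+kn]%n≡m%n; [m+n]%n≡m%n; m≡m%n+[m/n]*n)
open import Data.Nat.Divisibility using (_∣_; m%n≡0⇒n∣m; n∣m⇒m%n≡0)
open import Data.Nat.Primality using (Prime; euclidsLemma; prime⇒nonTrivial)
open import Data.Nat.Coprimality using (prime⇒coprime; coprime-Bézout)
open import Data.Nat.GCD using (module Bézout)
open import Data.Fin as Fin using (Fin; toℕ)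
import Data.Integer as ℤ
import Data.Integer.Properties as ℤₚ
open import Data.Fin.Properties using (toℕ-injective; toℕ<n; toℕ-fromℕ<; suc-injective; _≟_)
open import Data.Vec.Functional using (Vector; _∷_; _++_)
open import Data.Vec.Functional.Properties using (∷-cong; ++-cong; lookup-++ˡ; lookup-++ʳ)
open import Data.Sum.Properties using ([,]-map)
open import Relation.Binary.Core using (_Preserves_⟶_)
open import Data.Bool using (Bool; true; false; if_then_else_; _∧_)
open import Data.Bool.Properties using (∧-assoc)
open import Relation.Nullary.Decidable using (⌊_⌋; yes; no)
open import Function using (id; _∘_)
import Data.List as List
import Data.List.Properties as ListProps
import Data.Nat.ListAction as ListSum
open import Data.Maybe using (nothing)
open import Data.Sum using (_⊎_; inj₁; inj₂; [_,_]′)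
open import Data.Product using (∃; _,_; proj₁; proj₂)
open import Data.Empty using (⊥-elim)
open import Relation.Binary.PropositionalEquality
open import Algebra.Bundles using (Monoid; CommutativeRing)
import Algebra.Properties.Monoid.Sum as MonoidSum
import Algebra.Properties.Semiring.Sum as SemiringSum
import Algebra.Properties.Ring as RingProperties
import Algebra.Properties.Group as GroupProperties
import Algebra.Properties.Quasigroup as QuasigroupProperties
open import Tactic.RingSolver using (solve-∀)
open import Data.Nat.Tactic.RingSolver using () renaming (solve-∀ to ℕ-solve-∀)
open import Tactic.RingSolver.Core.AlmostCommutativeRing using (AlmostCommutativeRing; fromCommutativeRing)

module _ {a ℓ} (M : Monoid a ℓ) where
  open Monoid M using (Carrier; _≈_; ε; ∙-congˡ; ∙-congʳ; identityˡ; identityʳ) renaming (trans to ≈-trans)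
  open MonoidSum M using (sum; sum-cong-≋; sum-replicate-zero)

  sum-single : ∀ {k} (c : Fin k) (f : Vector Carrier k) → (∀ j → j ≢ c → f j ≈ ε) → sum f ≈ f c
  sum-single {suc k} Fin.zero f f≈ε =
    ≈-trans (∙-congˡ (≈-trans (sum-cong-≋ (λ j → f≈ε (Fin.suc j) λ ())) (sum-replicate-zero k))) (identityʳ _)
  sum-single {suc k} (Fin.suc c) f f≈ε =
    ≈-trans (∙-congʳ (f≈ε Fin.zero λ ()))
            (≈-trans (identityˡ _) (sum-single c (λ j → f (Fin.suc j)) (λ j j≢c → f≈ε (Fin.suc j) (j≢c ∘ suc-injective))))

*-pred-cancel-≤ : ∀ {a b q} → 2 ≤ q → a * q + b ≤ b * q + a → a ≤ b
*-pred-cancel-≤ {a} {b} {suc q} (s≤s 1≤q) aq+b≤bq+a =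
  ℕₚ.*-cancelʳ-≤ a b q {{ℕ.>-nonZero 1≤q}} (ℕₚ.+-cancelˡ-≤ (a + b) _ _
    (subst₂ _≤_ (regroup a b q) (trans (regroup b a q) (cong (_+ b * q) (ℕₚ.+-comm b a))) aq+b≤bq+a))
  where
  regroup : ∀ a b q → a * suc q + b ≡ (a + b) + a * q
  regroup = ℕ-solve-∀

double-count-≤ : ∀ {X a b q P} → 2 ≤ q → X + a ≡ a * q + P → X + b ≤ b * q + P → a ≤ b
double-count-≤ {X} {a} {b} {q} {P} 2≤q X+a≡ X+b≤ = *-pred-cancel-≤ 2≤q (ℕₚ.+-cancelʳ-≤ P _ _ (begin
  a * q + b + P    ≡⟨ regroup₁ (a * q) b P ⟩
  (a * q + P) + b  ≡⟨ cong (_+ b) X+a≡ ⟨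
  (X + a) + b      ≡⟨ regroup₂ X a b ⟩
  (X + b) + a      ≤⟨ ℕₚ.+-monoˡ-≤ a X+b≤ ⟩
  (b * q + P) + a  ≡⟨ regroup₁ (b * q) a P ⟨
  b * q + a + P    ∎))
  where
  open ℕₚ.≤-Reasoning
  regroup₁ : ∀ x y z → x + y + z ≡ (x + z) + y
  regroup₁ = ℕ-solve-∀
  regroup₂ : ∀ x y z → (x + y) + z ≡ (x + z) + y
  regroup₂ = ℕ-solve-∀

private
  ∣m-n∣²+2nm≡m²+n²-≤ : ∀ {m n} → m ≤ n → ℕ.∣ m - n ∣ * ℕ.∣ m - n ∣ + 2 * (n * m) ≡ m * m + n * n
  ∣m-n∣²+2nm≡m²+n²-≤ {m} m≤n with ℕₚ.m≤n⇒∃[o]m+o≡n m≤n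
  ... | k , refl = trans (cong (λ e → e * e + 2 * ((m + k) * m)) (trans (ℕₚ.m≤n⇒∣m-n∣≡n∸m m≤n) (ℕₚ.m+n∸m≡n m k)))
                         (expand m k)
    where
    expand : ∀ m k → k * k + 2 * ((m + k) * m) ≡ m * m + (m + k) * (m + k)
    expand = ℕ-solve-∀

∣m-n∣²+2nm≡m²+n² : ∀ m n → ℕ.∣ m - n ∣ * ℕ.∣ m - n ∣ + 2 * (n * m) ≡ m * m + n * n
∣m-n∣²+2nm≡m²+n² m n with ℕₚ.≤-total m n
... | inj₁ m≤n = ∣m-n∣²+2nm≡m²+n²-≤ m≤n
... | inj₂ n≤m = trans (cong₂ (λ e f → e * e + 2 * f) (ℕₚ.∣-∣-comm m n) (ℕₚ.*-comm n m))
                       (trans (∣m-n∣²+2nm≡m²+n²-≤ n≤m) (ℕₚ.+-comm (n * n) (m * m)))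

∣+m-+n∣≡∣m-n∣ : ∀ m n → ℤ.∣ ℤ.+ m ℤ.- ℤ.+ n ∣ ≡ ℕ.∣ m - n ∣
∣+m-+n∣≡∣m-n∣ m n with ℕₚ.≤-total m n
... | inj₁ m≤n = trans (cong ℤ.∣_∣ (ℤₚ.m-n≡m⊖n m n)) (trans (ℤₚ.∣⊖∣-≤ m≤n) (sym (ℕₚ.m≤n⇒∣m-n∣≡n∸m m≤n)))
... | inj₂ n≤m = trans (cong ℤ.∣_∣ (ℤₚ.m-n≡m⊖n m n))
                       (trans (cong ℤ.∣_∣ (ℤₚ.⊖-≥ n≤m)) (sym (trans (ℕₚ.∣-∣-comm m n) (ℕₚ.m≤n⇒∣m-n∣≡n∸m n≤m))))

m≤m+n+o : ∀ m n o → m ≤ m + n + o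
m≤m+n+o m n o = ℕₚ.≤-trans (ℕₚ.m≤m+n m n) (ℕₚ.m≤m+n (m + n) o)

n≤m+n+o : ∀ m n o → n ≤ m + n + o
n≤m+n+o m n o = ℕₚ.≤-trans (ℕₚ.m≤n+m n m) (ℕₚ.m≤m+n (m + n) o)

o≤m+n+o : ∀ m n o → o ≤ m + n + o
o≤m+n+o m n o = ℕₚ.m≤n+m o (m + n)

module ℕΣ = SemiringSum ℕₚ.+-*-semiring
open ℕΣ using (sum-syntax)

∑-const : ∀ k c → ∑[ i < k ] c ≡ k * c
∑-const zero    c = refl
∑-const (suc k) c = cong (c +_) (∑-const k c)

∑-*ʳ : ∀ {k} (f : Fin k → ℕ) c → ∑[ i < k ] (f i * c) ≡ (∑[ i < k ] f i) * c
∑-*ʳ f c = sym (ℕΣ.*-distribʳ-sum c f)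

module _ {A : Set} where

  sum-map-+ : ∀ (f g : A → ℕ) xs →
              ListSum.sum (List.map (λ x → f x + g x) xs) ≡ ListSum.sum (List.map f xs) + ListSum.sum (List.map g xs)
  sum-map-+ f g List.[]        = refl
  sum-map-+ f g (x List.∷ xs) = trans (cong (f x + g x +_) (sum-map-+ f g xs)) (+-interchange (f x) (g x) _ _)

  sum-map-*ˡ : ∀ c (f : A → ℕ) xs → ListSum.sum (List.map (λ x → c * f x) xs) ≡ c * ListSum.sum (List.map f xs)
  sum-map-*ˡ c f List.[]        = sym (ℕₚ.*-zeroʳ c)
  sum-map-*ˡ c f (x List.∷ xs) = trans (cong (c * f x +_) (sum-map-*ˡ c f xs)) (sym (ℕₚ.*-distribˡ-+ c (f x) _))

  sum-map-const : ∀ c (xs : List.List A) → ListSum.sum (List.map (λ _ → c) xs) ≡ List.length xs * c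
  sum-map-const c List.[]        = refl
  sum-map-const c (x List.∷ xs) = cong (c +_) (sum-map-const c xs)

  sum-map-mono : ∀ {f g : A → ℕ} → (∀ x → f x ≤ g x) → ∀ xs → ListSum.sum (List.map f xs) ≤ ListSum.sum (List.map g xs)
  sum-map-mono f≤g List.[]        = z≤n
  sum-map-mono f≤g (x List.∷ xs) = ℕₚ.+-mono-≤ (f≤g x) (sum-map-mono f≤g xs)

  sum-map-positive : ∀ (f : A → ℕ) xs → 0 < ListSum.sum (List.map f xs) → ∃ λ x → 0 < f x
  sum-map-positive f (x List.∷ xs) 0<∑ with f x in fx≡
  ... | suc _ = x , subst (0 <_) (sym fx≡) (s≤s z≤n)
  ... | zero  = sum-map-positive f xs 0<∑

sum-map-allFin : ∀ k (f : Fin k → ℕ) → ListSum.sum (List.map f (List.allFin k)) ≡ ∑[ i < k ] f i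
sum-map-allFin k f = trans (cong ListSum.sum (ListProps.map-tabulate id f)) (sum-tabulate k f)
  where
  sum-tabulate : ∀ k (f : Fin k → ℕ) → ListSum.sum (List.tabulate f) ≡ ∑[ i < k ] f i
  sum-tabulate zero    f = refl
  sum-tabulate (suc k) f = cong (f Fin.zero +_) (sum-tabulate k (λ i → f (Fin.suc i)))

-- The prime field

module _ (p : ℕ) .{{_ : NonZero p}} where

  -- 𝔽ₚ is Fin p with reduction mod p; every ring law is pulled back from ℕ through congruence mod p.
  infix 4 _≡ₚ_
  _≡ₚ_ : ℕ → ℕ → Set
  m ≡ₚ n = m % p ≡ n % p

  +-congₚ : ∀ {a b c d} → a ≡ₚ b → c ≡ₚ d → a + c ≡ₚ b + d
  +-congₚ {a} {b} {c} {d} a≡b c≡d = begin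
    (a + c) % p             ≡⟨ %-distribˡ-+ a c p ⟩
    (a % p + c % p) % p     ≡⟨ cong₂ (λ x y → (x + y) % p) a≡b c≡d ⟩
    (b % p + d % p) % p     ≡⟨ %-distribˡ-+ b d p ⟨
    (b + d) % p             ∎
    where open ≡-Reasoning

  *-congₚ : ∀ {a b c d} → a ≡ₚ b → c ≡ₚ d → a * c ≡ₚ b * d
  *-congₚ {a} {b} {c} {d} a≡b c≡d = begin
    (a * c) % p             ≡⟨ %-distribˡ-* a c p ⟩
    (a % p * (c % p)) % p   ≡⟨ cong₂ (λ x y → (x * y) % p) a≡b c≡d ⟩
    (b % p * (d % p)) % p   ≡⟨ %-distribˡ-* b d p ⟨
    (b * d) % p             ∎
    where open ≡-Reasoning

  toℕ-mod : ∀ m → toℕ (m mod p) ≡ₚ m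
  toℕ-mod m = trans (cong (_% p) (toℕ-fromℕ< (m%n<n m p))) (m%n%n≡m%n m p)

  toℕ-≡ₚ-injective : ∀ {a b : F p} → toℕ a ≡ₚ toℕ b → a ≡ b
  toℕ-≡ₚ-injective {a} {b} e =
    toℕ-injective (trans (sym (m<n⇒m%n≡m (toℕ<n a))) (trans e (m<n⇒m%n≡m (toℕ<n b))))

  mod-cong : ∀ {m n} → m ≡ₚ n → m mod p ≡ n mod p
  mod-cong {m} {n} e = toℕ-≡ₚ-injective (trans (toℕ-mod m) (trans e (sym (toℕ-mod n))))

  0%p≡0 : 0 % p ≡ 0
  0%p≡0 = m*n%n≡0 0 p

  toℕ-mod-inverse : ∀ (a : F p) → toℕ a mod p ≡ a
  toℕ-mod-inverse a = toℕ-≡ₚ-injective (toℕ-mod (toℕ a))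

  1F : F p
  1F = 1 mod p

  -F_ : F p → F p
  -F a = (p ∸ toℕ a) mod p

  private
    ⟦_⟧ : F p → ℕ
    ⟦_⟧ = toℕ

    +F-comm : ∀ a b → _+F_ p a b ≡ _+F_ p b a
    +F-comm a b = cong (_mod p) (ℕₚ.+-comm ⟦ a ⟧ ⟦ b ⟧)

    *F-comm : ∀ a b → _*F_ p a b ≡ _*F_ p b a
    *F-comm a b = cong (_mod p) (ℕₚ.*-comm ⟦ a ⟧ ⟦ b ⟧)

    +F-assoc : ∀ a b c → _+F_ p (_+F_ p a b) c ≡ _+F_ p a (_+F_ p b c)
    +F-assoc a b c = mod-cong (trans (+-congₚ (toℕ-mod (⟦ a ⟧ + ⟦ b ⟧)) refl)
      (trans (cong (_% p) (ℕₚ.+-assoc ⟦ a ⟧ ⟦ b ⟧ ⟦ c ⟧)) (sym (+-congₚ {⟦ a ⟧} refl (toℕ-mod (⟦ b ⟧ + ⟦ c ⟧))))))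

    *F-assoc : ∀ a b c → _*F_ p (_*F_ p a b) c ≡ _*F_ p a (_*F_ p b c)
    *F-assoc a b c = mod-cong (trans (*-congₚ (toℕ-mod (⟦ a ⟧ * ⟦ b ⟧)) refl)
      (trans (cong (_% p) (ℕₚ.*-assoc ⟦ a ⟧ ⟦ b ⟧ ⟦ c ⟧)) (sym (*-congₚ {⟦ a ⟧} refl (toℕ-mod (⟦ b ⟧ * ⟦ c ⟧))))))

    +F-identityˡ : ∀ a → _+F_ p (0F p) a ≡ a
    +F-identityˡ a = trans (mod-cong (+-congₚ (toℕ-mod 0) refl)) (toℕ-mod-inverse a)

    *F-identityˡ : ∀ a → _*F_ p 1F a ≡ a
    *F-identityˡ a = trans (mod-cong (trans (*-congₚ (toℕ-mod 1) refl) (cong (_% p) (ℕₚ.*-identityˡ ⟦ a ⟧))))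
                           (toℕ-mod-inverse a)

    -F-inverseˡ : ∀ a → _+F_ p (-F a) a ≡ 0F p
    -F-inverseˡ a = mod-cong (begin
      (⟦ -F a ⟧ + ⟦ a ⟧) % p         ≡⟨ +-congₚ (toℕ-mod (p ∸ ⟦ a ⟧)) refl ⟩
      ((p ∸ ⟦ a ⟧) + ⟦ a ⟧) % p      ≡⟨ cong (_% p) (ℕₚ.m∸n+n≡m (ℕₚ.<⇒≤ (toℕ<n a))) ⟩
      p % p                          ≡⟨ n%n≡0 p ⟩
      0                              ≡⟨ m*n%n≡0 0 p ⟨
      0 % p                          ∎)
      where open ≡-Reasoning

    *F-distribʳ : ∀ a b c → _*F_ p (_+F_ p a b) c ≡ _+F_ p (_*F_ p a c) (_*F_ p b c)
    *F-distribʳ a b c = mod-cong (trans (*-congₚ (toℕ-mod (⟦ a ⟧ + ⟦ b ⟧)) refl)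
      (trans (cong (_% p) (ℕₚ.*-distribʳ-+ ⟦ c ⟧ ⟦ a ⟧ ⟦ b ⟧))
             (sym (+-congₚ (toℕ-mod (⟦ a ⟧ * ⟦ c ⟧)) (toℕ-mod (⟦ b ⟧ * ⟦ c ⟧))))))

  𝔽-commutativeRing : CommutativeRing 0ℓ 0ℓ
  𝔽-commutativeRing = record
    { Carrier = F p ; _≈_ = _≡_ ; _+_ = _+F_ p ; _*_ = _*F_ p ; -_ = -F_ ; 0# = 0F p ; 1# = 1F
    ; isCommutativeRing = record
      { isRing = record
        { +-isAbelianGroup = record
          { isGroup = record
            { isMonoid = record
              { isSemigroup = record
                { isMagma = record { isEquivalence = isEquivalence ; ∙-cong = cong₂ (_+F_ p) }
                ; assoc = +F-assoc }
              ; identity = +F-identityˡ , λ a → trans (+F-comm a (0F p)) (+F-identityˡ a) }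
            ; inverse = -F-inverseˡ , λ a → trans (+F-comm a (-F a)) (-F-inverseˡ a)
            ; ⁻¹-cong = cong -F_ }
          ; comm = +F-comm }
        ; *-cong = cong₂ (_*F_ p)
        ; *-assoc = *F-assoc
        ; *-identity = *F-identityˡ , λ a → trans (*F-comm a 1F) (*F-identityˡ a)
        ; distrib = (λ a b c → trans (*F-comm a (_+F_ p b c))
                                 (trans (*F-distribʳ b c a) (cong₂ (_+F_ p) (*F-comm b a) (*F-comm c a))))
                  , (λ a b c → *F-distribʳ b c a) }
      ; *-comm = *F-comm } }

  module 𝔽 = CommutativeRing 𝔽-commutativeRing
  module 𝔽Σ = SemiringSum 𝔽.semiring
  module 𝔽Ring = RingProperties 𝔽.ring
  module 𝔽Group = GroupProperties 𝔽.+-group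
  module 𝔽Quasigroup = QuasigroupProperties 𝔽Group.quasigroup
  module 𝔽* = CommutativeSemigroupProperties 𝔽.*-commutativeSemigroup
  module 𝔽+ = CommutativeSemigroupProperties 𝔽.+-commutativeSemigroup

  -- The ring solver cannot compute with coefficients (they are stuck on the variable p), so it is only
  -- used to rearrange sums.
  𝔽-almostCommutativeRing : AlmostCommutativeRing 0ℓ 0ℓ
  𝔽-almostCommutativeRing = fromCommutativeRing 𝔽-commutativeRing (λ _ → nothing)

  open AlmostCommutativeRing 𝔽-almostCommutativeRing public using ()
    renaming (_+_ to _+ᶠ_; _*_ to _*ᶠ_; -_ to -ᶠ_; 0# to 0ᶠ; 1# to 1ᶠ)

  ΣF≡sum : ∀ k (f : Fin k → F p) → ΣF p k f ≡ 𝔽Σ.sum f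
  ΣF≡sum zero    f = refl
  ΣF≡sum (suc k) f = cong (f Fin.zero +ᶠ_) (ΣF≡sum k (λ i → f (Fin.suc i)))

  ΣF-cong : ∀ k {f g : Fin k → F p} → (∀ i → f i ≡ g i) → ΣF p k f ≡ ΣF p k g
  ΣF-cong zero    f≗g = refl
  ΣF-cong (suc k) f≗g = cong₂ _+ᶠ_ (f≗g Fin.zero) (ΣF-cong k (λ i → f≗g (Fin.suc i)))

  ΣF-+ : ∀ k (f g : Fin k → F p) → ΣF p k (λ i → f i +ᶠ g i) ≡ ΣF p k f +ᶠ ΣF p k g
  ΣF-+ k f g = trans (ΣF≡sum k _) (trans (𝔽Σ.∑-distrib-+ f g) (sym (cong₂ _+ᶠ_ (ΣF≡sum k f) (ΣF≡sum k g))))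

  ΣF-*ˡ : ∀ k c (f : Fin k → F p) → ΣF p k (λ i → c *ᶠ f i) ≡ c *ᶠ ΣF p k f
  ΣF-*ˡ k c f = trans (ΣF≡sum k _) (sym (trans (cong (c *ᶠ_) (ΣF≡sum k f)) (𝔽Σ.*-distribˡ-sum c f)))

  ΣF-*ʳ : ∀ k (f : Fin k → F p) c → ΣF p k (λ i → f i *ᶠ c) ≡ ΣF p k f *ᶠ c
  ΣF-*ʳ k f c = trans (ΣF≡sum k _) (sym (trans (cong (_*ᶠ c) (ΣF≡sum k f)) (𝔽Σ.*-distribʳ-sum c f)))

  ΣF-comm : ∀ k m (f : Fin k → Fin m → F p) →
            ΣF p k (λ i → ΣF p m (f i)) ≡ ΣF p m (λ j → ΣF p k (λ i → f i j))
  ΣF-comm k m f = begin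
    ΣF p k (λ i → ΣF p m (f i))            ≡⟨ ΣF-cong k (λ i → ΣF≡sum m (f i)) ⟩
    ΣF p k (λ i → 𝔽Σ.sum (f i))            ≡⟨ ΣF≡sum k _ ⟩
    𝔽Σ.sum (λ i → 𝔽Σ.sum (f i))            ≡⟨ 𝔽Σ.∑-comm f ⟩
    𝔽Σ.sum (λ j → 𝔽Σ.sum (λ i → f i j))   ≡⟨ ΣF≡sum m _ ⟨
    ΣF p m (λ j → 𝔽Σ.sum (λ i → f i j))    ≡⟨ ΣF-cong m (λ j → ΣF≡sum k (λ i → f i j)) ⟨
    ΣF p m (λ j → ΣF p k (λ i → f i j))    ∎
    where open ≡-Reasoning

  ΣF-zero : ∀ k → ΣF p k (λ _ → 0ᶠ) ≡ 0ᶠ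
  ΣF-zero k = trans (ΣF≡sum k _) (𝔽Σ.sum-replicate-zero k)

  ΣF-neg : ∀ k (f : Fin k → F p) → ΣF p k (λ i → -ᶠ f i) ≡ -ᶠ ΣF p k f
  ΣF-neg k f = trans (ΣF-cong k (λ i → sym (𝔽Ring.-1*x≈-x (f i))))
                     (trans (ΣF-*ˡ k (-ᶠ 1ᶠ) f) (𝔽Ring.-1*x≈-x (ΣF p k f)))

  ΣF-++ : ∀ k l (f : Fin (k + l) → F p) →
          ΣF p (k + l) f ≡ ΣF p k (λ i → f (i Fin.↑ˡ l)) +ᶠ ΣF p l (λ j → f (k Fin.↑ʳ j))
  ΣF-++ zero    l f = sym (𝔽.+-identityˡ _)
  ΣF-++ (suc k) l f = trans (cong (f Fin.zero +ᶠ_) (ΣF-++ k l (λ i → f (Fin.suc i))))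
                            (sym (𝔽.+-assoc _ _ _))

  δ : ∀ {k} → Fin k → Fin k → F p
  δ i j = if ⌊ i ≟ j ⌋ then 1ᶠ else 0ᶠ

  δ-refl : ∀ {k} (i : Fin k) → δ i i ≡ 1ᶠ
  δ-refl i with i ≟ i
  ... | yes _   = refl
  ... | no i≢i = ⊥-elim (i≢i refl)

  δ-≢ : ∀ {k} {i j : Fin k} → i ≢ j → δ i j ≡ 0ᶠ
  δ-≢ {i = i} {j} i≢j with i ≟ j
  ... | yes i≡j = ⊥-elim (i≢j i≡j)
  ... | no _    = refl

  ΣF-δ : ∀ k (c : Fin k) (g : Fin k → F p) → ΣF p k (λ j → δ j c *ᶠ g j) ≡ g c
  ΣF-δ k c g = begin
    ΣF p k (λ j → δ j c *ᶠ g j)     ≡⟨ ΣF≡sum k _ ⟩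
    𝔽Σ.sum (λ j → δ j c *ᶠ g j)     ≡⟨ sum-single 𝔽.+-monoid c _ (λ j j≢c → trans (cong (_*ᶠ g j) (δ-≢ j≢c)) (𝔽.zeroˡ (g j))) ⟩
    δ c c *ᶠ g c                    ≡⟨ trans (cong (_*ᶠ g c) (δ-refl c)) (𝔽.*-identityˡ (g c)) ⟩
    g c                             ∎
    where open ≡-Reasoning

  infix 4 _=ᶠ_ _=ᵛ_

  _=ᶠ_ : F p → F p → Bool
  a =ᶠ b = ⌊ a ≟ b ⌋

  _=ᵛ_ : ∀ {n} → Vec p n → Vec p n → Bool
  _=ᵛ_ {n} u v = allB p n (λ i → u i =ᶠ v i)

  𝟙≤1 : ∀ b → 𝟙 p b ≤ 1
  𝟙≤1 true  = s≤s z≤n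
  𝟙≤1 false = z≤n

  𝟙*≤ : ∀ b z → 𝟙 p b * z ≤ z
  𝟙*≤ true  z = ℕₚ.≤-reflexive (ℕₚ.+-identityʳ z)
  𝟙*≤ false z = z≤n

  𝟙-mono : ∀ {b c} → (b ≡ true → c ≡ true) → 𝟙 p b ≤ 𝟙 p c
  𝟙-mono {false} b⇒c = z≤n
  𝟙-mono {true}  b⇒c rewrite b⇒c refl = s≤s z≤n

  𝟙-positive : ∀ {b} → 0 < 𝟙 p b → b ≡ true
  𝟙-positive {true} _ = refl

  𝟙-∧ : ∀ b c → 𝟙 p (b ∧ c) ≡ 𝟙 p b * 𝟙 p c
  𝟙-∧ true  c = sym (ℕₚ.+-identityʳ (𝟙 p c))
  𝟙-∧ false c = refl

  𝟙-redundant : ∀ a b c e → (a ≡ true → b ≡ true → e ≡ true → c ≡ true) →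
                ((𝟙 p a * 𝟙 p b) * 𝟙 p c) * 𝟙 p e ≡ 𝟙 p e * (𝟙 p a * 𝟙 p b)
  𝟙-redundant false b     c     e     _ = sym (ℕₚ.*-zeroʳ (𝟙 p e))
  𝟙-redundant true  false c     e     _ = sym (ℕₚ.*-zeroʳ (𝟙 p e))
  𝟙-redundant true  true  c     false _ = ℕₚ.*-zeroʳ ((𝟙 p true * 𝟙 p true) * 𝟙 p c)
  𝟙-redundant true  true  c     true  ⇒c rewrite ⇒c refl refl refl = refl

  𝟙[=ᶠ]-≢ : ∀ {a b} → a ≢ b → 𝟙 p (a =ᶠ b) ≡ 0
  𝟙[=ᶠ]-≢ {a} {b} a≢b with a ≟ b
  ... | yes a≡b = ⊥-elim (a≢b a≡b)
  ... | no _    = refl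

  𝟙[=ᶠ]-≡ : ∀ {a b} → a ≡ b → 𝟙 p (a =ᶠ b) ≡ 1
  𝟙[=ᶠ]-≡ {a} {b} a≡b with a ≟ b
  ... | yes _   = refl
  ... | no a≢b = ⊥-elim (a≢b a≡b)

  =ᶠ-cong-⇔ : ∀ {a b a' b'} → (a ≡ b → a' ≡ b') → (a' ≡ b' → a ≡ b) → (a =ᶠ b) ≡ (a' =ᶠ b')
  =ᶠ-cong-⇔ {a} {b} {a'} {b'} to from with a ≟ b | a' ≟ b'
  ... | yes _   | yes _     = refl
  ... | no _    | no _      = refl
  ... | yes a≡b | no a'≢b'  = ⊥-elim (a'≢b' (to a≡b))
  ... | no a≢b  | yes a'≡b' = ⊥-elim (a≢b (from a'≡b'))

  allB-cong : ∀ k {f g : Fin k → Bool} → (∀ i → f i ≡ g i) → allB p k f ≡ allB p k g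
  allB-cong zero    f≗g = refl
  allB-cong (suc k) f≗g = cong₂ _∧_ (f≗g Fin.zero) (allB-cong k (λ i → f≗g (Fin.suc i)))

  allB-++ : ∀ k l (f : Fin (k + l) → Bool) →
            allB p (k + l) f ≡ allB p k (λ i → f (i Fin.↑ˡ l)) ∧ allB p l (λ j → f (k Fin.↑ʳ j))
  allB-++ zero    l f = refl
  allB-++ (suc k) l f = trans (cong (f Fin.zero ∧_) (allB-++ k l (λ i → f (Fin.suc i)))) (sym (∧-assoc (f Fin.zero) _ _))

  =ᵛ-sound : ∀ {n} {u v : Vec p n} → (u =ᵛ v) ≡ true → u ≗ v
  =ᵛ-sound {suc n} {u} {v} u=v i with u Fin.zero ≟ v Fin.zero
  =ᵛ-sound {suc n} {u} {v} u=v Fin.zero    | yes u₀≡v₀ = u₀≡v₀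
  =ᵛ-sound {suc n} {u} {v} u=v (Fin.suc i) | yes _     = =ᵛ-sound {n} {u ∘ Fin.suc} {v ∘ Fin.suc} u=v i

  =ᵛ-complete : ∀ {n} {u v : Vec p n} → u ≗ v → (u =ᵛ v) ≡ true
  =ᵛ-complete {zero}          u≗v = refl
  =ᵛ-complete {suc n} {u} {v} u≗v with u Fin.zero ≟ v Fin.zero
  ... | yes _     = =ᵛ-complete {n} {u ∘ Fin.suc} {v ∘ Fin.suc} (u≗v ∘ Fin.suc)
  ... | no u₀≢v₀ = ⊥-elim (u₀≢v₀ (u≗v Fin.zero))

  =ᵛ-false : ∀ {n} {u v : Vec p n} → (u =ᵛ v) ≡ false → ∃ λ i → u i ≢ v i
  =ᵛ-false {suc n} {u} {v} u≠v with u Fin.zero ≟ v Fin.zero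
  ... | no u₀≢v₀ = Fin.zero , u₀≢v₀
  ... | yes _ with =ᵛ-false {n} {u ∘ Fin.suc} {v ∘ Fin.suc} u≠v
  ...   | i , uᵢ≢vᵢ = Fin.suc i , uᵢ≢vᵢ

  =ᵛ-cong : ∀ {n} {u u' v v' : Vec p n} → u ≗ u' → v ≗ v' → (u =ᵛ v) ≡ (u' =ᵛ v')
  =ᵛ-cong {n} u≗u' v≗v' = allB-cong n (λ i → cong₂ _=ᶠ_ (u≗u' i) (v≗v' i))

  =ᶠ-cancelˡ : ∀ {a b a' b'} z → a ≡ z +ᶠ a' → b ≡ z +ᶠ b' → (a =ᶠ b) ≡ (a' =ᶠ b')
  =ᶠ-cancelˡ z a≡ b≡ = =ᶠ-cong-⇔ (λ a≡b → 𝔽Quasigroup.cancelˡ z _ _ (trans (sym a≡) (trans a≡b b≡)))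
                                 (λ a'≡b' → trans a≡ (trans (cong (z +ᶠ_) a'≡b') (sym b≡)))

  =ᵛ-++ : ∀ {k l} (u v : Vec p k) (u' v' : Vec p l) → ((u ++ u') =ᵛ (v ++ v')) ≡ (u =ᵛ v) ∧ (u' =ᵛ v')
  =ᵛ-++ {k} {l} u v u' v' = trans (allB-++ k l _)
    (cong₂ _∧_ (allB-cong k (λ i → cong₂ _=ᶠ_ (lookup-++ˡ u u' i) (lookup-++ˡ v v' i)))
               (allB-cong l (λ i → cong₂ _=ᶠ_ (lookup-++ʳ u u' i) (lookup-++ʳ v v' i))))

  -- Sums over H = 𝔽ₚⁿ

  sumH-cong : ∀ n {g h : Vec p n → ℕ} → (∀ x → g x ≡ h x) → sumH p n g ≡ sumH p n h
  sumH-cong zero    g≗h = g≗h _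
  sumH-cong (suc n) g≗h =
    cong ListSum.sum (ListProps.map-cong (λ a → sumH-cong n (λ v → g≗h _)) (List.allFin p))

  -- sumH builds the summation vectors with a pattern lambda, so unfolding it needs g to respect ≗.
  sumH-unfold : ∀ n (g : Vec p (suc n) → ℕ) → g Preserves _≗_ ⟶ _≡_ →
                sumH p (suc n) g ≡ ∑[ a < p ] sumH p n (λ v → g (a ∷ v))
  sumH-unfold n g g-ext =
    trans (sum-map-allFin p _)
          (ℕΣ.sum-cong-≗ {y = λ a → sumH p n (λ v → g (a ∷ v))}
                         (λ a → sumH-cong n (λ v → g-ext λ { Fin.zero → refl ; (Fin.suc i) → refl })))

  sumH-+ : ∀ n (g h : Vec p n → ℕ) → sumH p n (λ x → g x + h x) ≡ sumH p n g + sumH p n h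
  sumH-+ zero    g h = refl
  sumH-+ (suc n) g h =
    trans (cong ListSum.sum (ListProps.map-cong (λ a → sumH-+ n _ _) (List.allFin p))) (sum-map-+ _ _ (List.allFin p))

  sumH-*ˡ : ∀ n c (g : Vec p n → ℕ) → sumH p n (λ x → c * g x) ≡ c * sumH p n g
  sumH-*ˡ zero    c g = refl
  sumH-*ˡ (suc n) c g =
    trans (cong ListSum.sum (ListProps.map-cong (λ a → sumH-*ˡ n c _) (List.allFin p))) (sum-map-*ˡ c _ (List.allFin p))

  sumH-*ʳ : ∀ n (g : Vec p n → ℕ) c → sumH p n (λ x → g x * c) ≡ sumH p n g * c
  sumH-*ʳ n g c =
    trans (sumH-cong n (λ x → ℕₚ.*-comm (g x) c)) (trans (sumH-*ˡ n c g) (ℕₚ.*-comm c (sumH p n g)))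

  sumH-const : ∀ n c → sumH p n (λ _ → c) ≡ p ^ n * c
  sumH-const zero    c = sym (ℕₚ.+-identityʳ c)
  sumH-const (suc n) c =
    trans (cong ListSum.sum (ListProps.map-cong (λ a → sumH-const n c) (List.allFin p)))
          (trans (sum-map-const _ (List.allFin p))
                 (trans (cong (_* (p ^ n * c)) (ListProps.length-tabulate {n = p} id)) (sym (ℕₚ.*-assoc p (p ^ n) c))))

  sumH-mono : ∀ n {g h : Vec p n → ℕ} → (∀ x → g x ≤ h x) → sumH p n g ≤ sumH p n h
  sumH-mono zero    g≤h = g≤h _
  sumH-mono (suc n) g≤h = sum-map-mono (λ a → sumH-mono n (λ v → g≤h _)) (List.allFin p)

  sumH-comm : ∀ n m (g : Vec p n → Vec p m → ℕ) →
              sumH p n (λ x → sumH p m (g x)) ≡ sumH p m (λ y → sumH p n (λ x → g x y))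
  sumH-comm zero    m g = refl
  sumH-comm (suc n) m g =
    trans (cong ListSum.sum (ListProps.map-cong (λ a → sumH-comm n m _) (List.allFin p))) (sum-map-sumH _ (List.allFin p))
    where
    sum-map-sumH : ∀ {A : Set} (f : A → Vec p m → ℕ) xs →
                   ListSum.sum (List.map (λ a → sumH p m (f a)) xs) ≡ sumH p m (λ y → ListSum.sum (List.map (λ a → f a y) xs))
    sum-map-sumH f List.[]        = sym (trans (sumH-const m 0) (ℕₚ.*-zeroʳ (p ^ m)))
    sum-map-sumH f (x List.∷ xs) = trans (cong (sumH p m (f x) +_) (sum-map-sumH f xs)) (sym (sumH-+ m _ _))

  sumH-*-sumH : ∀ n m (g : Vec p n → ℕ) (h : Vec p m → ℕ) →
                sumH p n g * sumH p m h ≡ sumH p n (λ x → sumH p m (λ y → g x * h y))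
  sumH-*-sumH n m g h = trans (sym (sumH-*ʳ n g (sumH p m h))) (sumH-cong n (λ x → sym (sumH-*ˡ m (g x) h)))

  ∑-sumH : ∀ {k} m (f : Fin k → Vec p m → ℕ) → ∑[ i < k ] sumH p m (f i) ≡ sumH p m (λ y → ∑[ i < k ] f i y)
  ∑-sumH {zero}  m f = sym (trans (sumH-const m 0) (ℕₚ.*-zeroʳ (p ^ m)))
  ∑-sumH {suc k} m f = trans (cong (sumH p m (f Fin.zero) +_) (∑-sumH m (f ∘ Fin.suc))) (sym (sumH-+ m _ _))

  sumH-pull₂ : ∀ m k (g : Vec p m → Vec p k → Vec p k → ℕ) →
               sumH p m (λ z → sumH p k (λ a → sumH p k (λ b → g z a b))) ≡ sumH p k (λ a → sumH p k (λ b → sumH p m (λ z → g z a b)))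
  sumH-pull₂ m k g = trans (sumH-comm m k (λ z a → sumH p k (λ b → g z a b))) (sumH-cong k (λ a → sumH-comm m k (λ z b → g z a b)))

  sumH-positive : ∀ n (g : Vec p n → ℕ) → 0 < sumH p n g → ∃ λ x → 0 < g x
  sumH-positive zero    g 0<g = _ , 0<g
  sumH-positive (suc n) g 0<∑ with sum-map-positive _ (List.allFin p) 0<∑
  ... | a , 0<ga with sumH-positive n _ 0<ga
  ...   | v , 0<gav = _ , 0<gav

  sumH-δ : ∀ n (u : Vec p n) (g : Vec p n → ℕ) → g Preserves _≗_ ⟶ _≡_ →
           sumH p n (λ x → 𝟙 p (u =ᵛ x) * g x) ≡ g u
  sumH-δ zero    u g g-ext = trans (ℕₚ.+-identityʳ (g _)) (g-ext (λ ()))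
  sumH-δ (suc n) u g g-ext = begin
    sumH p (suc n) (λ x → 𝟙 p (u =ᵛ x) * g x)
      ≡⟨ sumH-unfold n (λ x → 𝟙 p (u =ᵛ x) * g x)
           (λ x≗y → cong₂ (λ b z → 𝟙 p b * z) (=ᵛ-cong {u = u} {u' = u} (λ _ → refl) x≗y) (g-ext x≗y)) ⟩
    ∑[ a < p ] sumH p n (λ v → 𝟙 p ((u Fin.zero =ᶠ a) ∧ (u ∘ Fin.suc =ᵛ v)) * g (a ∷ v))
      ≡⟨ ℕΣ.sum-cong-≗ (λ a → sumH-cong n (λ v → trans (cong (_* g (a ∷ v)) (𝟙-∧ (u Fin.zero =ᶠ a) _))
                                                       (ℕₚ.*-assoc (𝟙 p (u Fin.zero =ᶠ a)) _ _))) ⟩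
    ∑[ a < p ] sumH p n (λ v → 𝟙 p (u Fin.zero =ᶠ a) * (𝟙 p (u ∘ Fin.suc =ᵛ v) * g (a ∷ v)))
      ≡⟨ ℕΣ.sum-cong-≗ (λ a → trans (sumH-*ˡ n (𝟙 p (u Fin.zero =ᶠ a)) (λ v → 𝟙 p (u ∘ Fin.suc =ᵛ v) * g (a ∷ v)))
           (cong (𝟙 p (u Fin.zero =ᶠ a) *_)
                 (sumH-δ n (u ∘ Fin.suc) (λ v → g (a ∷ v)) (λ v≗w → g-ext (∷-cong {xs = a ∷ _} {ys = a ∷ _} refl v≗w))))) ⟩
    ∑[ a < p ] (𝟙 p (u Fin.zero =ᶠ a) * g (a ∷ (u ∘ Fin.suc)))
      ≡⟨ sum-single ℕₚ.+-0-monoid (u Fin.zero) (λ a → 𝟙 p (u Fin.zero =ᶠ a) * g (a ∷ (u ∘ Fin.suc)))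
                    (λ a a≢u₀ → cong (_* g (a ∷ (u ∘ Fin.suc))) (𝟙[=ᶠ]-≢ (a≢u₀ ∘ sym))) ⟩
    𝟙 p (u Fin.zero =ᶠ u Fin.zero) * g (u Fin.zero ∷ (u ∘ Fin.suc))
      ≡⟨ cong₂ _*_ (𝟙[=ᶠ]-≡ {u Fin.zero} refl) (g-ext {u Fin.zero ∷ (u ∘ Fin.suc)} {u} (λ { Fin.zero → refl ; (Fin.suc i) → refl })) ⟩
    1 * g u
      ≡⟨ ℕₚ.*-identityˡ (g u) ⟩
    g u ∎
    where open ≡-Reasoning

  sumH-δ-1 : ∀ n (u : Vec p n) → sumH p n (λ x → 𝟙 p (u =ᵛ x)) ≡ 1
  sumH-δ-1 n u = trans (sumH-cong n (λ x → sym (ℕₚ.*-identityʳ (𝟙 p (u =ᵛ x))))) (sumH-δ n u (λ _ → 1) (λ _ → refl))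

  term≤sumH : ∀ n (u : Vec p n) (g : Vec p n → ℕ) → g Preserves _≗_ ⟶ _≡_ → g u ≤ sumH p n g
  term≤sumH n u g g-ext = subst (_≤ sumH p n g) (sumH-δ n u g g-ext) (sumH-mono n (λ x → 𝟙*≤ (u =ᵛ x) (g x)))

  sumH≤1 : ∀ n (g : Vec p n → ℕ) → (∀ x → g x ≤ 1) → (∀ x y → 0 < g x → 0 < g y → x ≗ y) → sumH p n g ≤ 1
  sumH≤1 n g g≤1 unique with sumH p n g in ∑≡
  ... | zero  = z≤n
  ... | suc _ with sumH-positive n g (subst (0 <_) (sym ∑≡) (s≤s z≤n))
  ...   | w , 0<gw = subst (_≤ 1) ∑≡ (subst (sumH p n g ≤_) (sumH-δ-1 n w) (sumH-mono n g≤δ))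
    where
    g≤δ : ∀ x → g x ≤ 𝟙 p (w =ᵛ x)
    g≤δ x with g x in gx≡
    ... | zero  = z≤n
    ... | suc _ = subst (λ b → suc _ ≤ 𝟙 p b) (sym (=ᵛ-complete (unique w x 0<gw (subst (0 <_) (sym gx≡) (s≤s z≤n)))))
                        (subst (_≤ 1) gx≡ (g≤1 x))

  infixl 6 _+ᵛ_
  _+ᵛ_ : ∀ {n} → Vec p n → Vec p n → Vec p n
  _+ᵛ_ = _+V_ p

  sumH-translate : ∀ n (g : Vec p n → ℕ) (v : Vec p n) → g Preserves _≗_ ⟶ _≡_ →
                   sumH p n (λ x → g (x +ᵛ v)) ≡ sumH p n g
  sumH-translate n g v g-ext = begin
    sumH p n (λ x → g (x +ᵛ v))                                  ≡⟨ sumH-cong n (λ x → sumH-δ n (x +ᵛ v) g g-ext) ⟨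
    sumH p n (λ x → sumH p n (λ c → 𝟙 p (x +ᵛ v =ᵛ c) * g c))    ≡⟨ sumH-comm n n _ ⟩
    sumH p n (λ c → sumH p n (λ x → 𝟙 p (x +ᵛ v =ᵛ c) * g c))    ≡⟨ sumH-cong n (λ c → sumH-*ʳ n _ (g c)) ⟩
    sumH p n (λ c → sumH p n (λ x → 𝟙 p (x +ᵛ v =ᵛ c)) * g c)    ≡⟨ sumH-cong n (λ c → cong (_* g c) (preimage-1 c)) ⟩
    sumH p n (λ c → 1 * g c)                                     ≡⟨ sumH-cong n (λ c → ℕₚ.*-identityˡ (g c)) ⟩
    sumH p n g                                                   ∎
    where
    open ≡-Reasoning
    preimage-1 : ∀ c → sumH p n (λ x → 𝟙 p (x +ᵛ v =ᵛ c)) ≡ 1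
    preimage-1 c = trans (sumH-cong n (λ x → cong (𝟙 p) (allB-cong n (λ i →
      =ᶠ-cong-⇔ (λ x+v≡c → trans (cong (_+ᶠ -ᶠ v i) (sym x+v≡c)) (𝔽Group.//-rightDividesʳ (v i) (x i)))
                (λ c-v≡x → trans (cong (_+ᶠ v i) (sym c-v≡x)) (𝔽Group.//-rightDividesˡ (v i) (c i)))))))
      (sumH-δ-1 n (λ i → c i +ᶠ -ᶠ v i))

  ∷-++ : ∀ {k l} (a : F p) (u : Vec p k) (v : Vec p l) → (a ∷ u) ++ v ≗ a ∷ (u ++ v)
  ∷-++ a u v Fin.zero        = refl
  ∷-++ {k} a u v (Fin.suc i) = [,]-map (Fin.splitAt k i)

  sumH-++ : ∀ k l (g : Vec p (k + l) → ℕ) → g Preserves _≗_ ⟶ _≡_ →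
            sumH p (k + l) g ≡ sumH p k (λ u → sumH p l (λ v → g (u ++ v)))
  sumH-++ zero    l g g-ext = refl
  sumH-++ (suc k) l g g-ext = begin
    sumH p (suc k + l) g
      ≡⟨ sumH-unfold (k + l) g g-ext ⟩
    ∑[ a < p ] sumH p (k + l) (λ w → g (a ∷ w))
      ≡⟨ ℕΣ.sum-cong-≗ (λ a → sumH-++ k l (λ w → g (a ∷ w)) (λ w≗w' → g-ext (∷-cong {xs = a ∷ _} {ys = a ∷ _} refl w≗w'))) ⟩
    ∑[ a < p ] sumH p k (λ u → sumH p l (λ v → g (a ∷ (u ++ v))))
      ≡⟨ ℕΣ.sum-cong-≗ (λ a → sumH-cong k (λ u → sumH-cong l (λ v → g-ext (λ i → sym (∷-++ a u v i))))) ⟩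
    ∑[ a < p ] sumH p k (λ u → sumH p l (λ v → g ((a ∷ u) ++ v)))
      ≡⟨ sumH-unfold k (λ u → sumH p l (λ v → g (u ++ v))) (λ {u} {u'} u≗u' → sumH-cong l (λ v → g-ext (++-cong u u' u≗u' (λ _ → refl)))) ⟨
    sumH p (suc k) (λ u → sumH p l (λ v → g (u ++ v)))
      ∎
    where open ≡-Reasoning

  -- Linear algebra over 𝔽ₚ

  dot : ∀ {n} → Vec p n → Vec p n → F p
  dot {n} u x = ΣF p n (λ j → u j *ᶠ x j)

  dot-congʳ : ∀ {n} (u : Vec p n) {x y : Vec p n} → x ≗ y → dot u x ≡ dot u y
  dot-congʳ {n} u x≗y = ΣF-cong n (λ j → cong (u j *ᶠ_) (x≗y j))

  dot-congˡ : ∀ {n} {u v : Vec p n} → u ≗ v → ∀ x → dot u x ≡ dot v x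
  dot-congˡ {n} u≗v x = ΣF-cong n (λ j → cong (_*ᶠ x j) (u≗v j))

  dot-+ʳ : ∀ {n} (u x y : Vec p n) → dot u (x +ᵛ y) ≡ dot u x +ᶠ dot u y
  dot-+ʳ {n} u x y = trans (ΣF-cong n (λ j → 𝔽.distribˡ (u j) (x j) (y j))) (ΣF-+ n _ _)

  infixr 7 _*ᴹ_
  _*ᴹ_ : ∀ {n} → (Fin n → Fin n → F p) → Vec p n → Vec p n
  (M *ᴹ h) i = dot (M i) h

  *ᴹ-+ : ∀ {n} (M : Fin n → Fin n → F p) (h w : Vec p n) → M *ᴹ (h +ᵛ w) ≗ M *ᴹ h +ᵛ M *ᴹ w
  *ᴹ-+ M h w i = dot-+ʳ (M i) h w

  *ᴹ-cong : ∀ {n} (M : Fin n → Fin n → F p) {h w : Vec p n} → h ≗ w → M *ᴹ h ≗ M *ᴹ w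
  *ᴹ-cong M h≗w i = dot-congʳ (M i) h≗w

  affine : ∀ {n m} → (Fin m → Vec p n) → Vec p m → Vec p n → Vec p m
  affine B t x i = dot (B i) x +ᶠ t i

  combine : ∀ {n m} → (Fin m → Vec p n) → Vec p m → Vec p n
  combine {m = m} B l j = ΣF p m (λ i → l i *ᶠ B i j)

  -- the + 0ᶠ gives the shape dot u x +ᶠ s of hyperplane-count-≡
  dot-affine : ∀ {n m} (B : Fin m → Vec p n) (t : Vec p m) (x : Vec p n) (l : Vec p m) → dot (affine B t x) l +ᶠ 0ᶠ ≡ dot (combine B l) x +ᶠ dot t l
  dot-affine {n} {m} B t x l = begin
    dot (affine B t x) l +ᶠ 0ᶠ
      ≡⟨ 𝔽.+-identityʳ _ ⟩
    ΣF p m (λ i → (dot (B i) x +ᶠ t i) *ᶠ l i)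
      ≡⟨ trans (ΣF-cong m (λ i → 𝔽.distribʳ (l i) (dot (B i) x) (t i))) (ΣF-+ m _ _) ⟩
    ΣF p m (λ i → dot (B i) x *ᶠ l i) +ᶠ ΣF p m (λ i → t i *ᶠ l i)
      ≡⟨ cong (_+ᶠ dot t l) rows-to-columns ⟩
    dot (combine B l) x +ᶠ dot t l ∎
    where
    open ≡-Reasoning
    rows-to-columns : ΣF p m (λ i → dot (B i) x *ᶠ l i) ≡ dot (combine B l) x
    rows-to-columns = begin
      ΣF p m (λ i → ΣF p n (λ j → B i j *ᶠ x j) *ᶠ l i)     ≡⟨ ΣF-cong m (λ i → sym (ΣF-*ʳ n _ (l i))) ⟩
      ΣF p m (λ i → ΣF p n (λ j → (B i j *ᶠ x j) *ᶠ l i))   ≡⟨ ΣF-comm m n _ ⟩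
      ΣF p n (λ j → ΣF p m (λ i → (B i j *ᶠ x j) *ᶠ l i))   ≡⟨ ΣF-cong n (λ j → ΣF-cong m (λ i → 𝔽*.xy∙z≈xz∙y (B i j) (x j) (l i))) ⟩
      ΣF p n (λ j → ΣF p m (λ i → (B i j *ᶠ l i) *ᶠ x j))   ≡⟨ ΣF-cong n (λ j → ΣF-*ʳ m _ (x j)) ⟩
      ΣF p n (λ j → ΣF p m (λ i → B i j *ᶠ l i) *ᶠ x j)     ≡⟨ ΣF-cong n (λ j → cong (_*ᶠ x j) (ΣF-cong m (λ i → 𝔽.*-comm (B i j) (l i)))) ⟩
      dot (combine B l) x ∎

  affine-++ : ∀ {n k l} (A : Fin k → Vec p n) (A' : Fin l → Vec p n) s s' x →
              affine (A ++ A') (s ++ s') x ≗ affine A s x ++ affine A' s' x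
  affine-++ {k = k} A A' s s' x i with Fin.splitAt k i
  ... | inj₁ _ = refl
  ... | inj₂ _ = refl

  combine-++ : ∀ {n k l} (A : Fin k → Vec p n) (A' : Fin l → Vec p n) (κ : Vec p k) (μ : Vec p l) j →
               combine (A ++ A') (κ ++ μ) j ≡ combine A κ j +ᶠ combine A' μ j
  combine-++ {k = k} {l} A A' κ μ j = trans (ΣF-++ k l _)
    (cong₂ _+ᶠ_ (ΣF-cong k (λ i → cong₂ (λ a B → a *ᶠ B j) (lookup-++ˡ κ μ i) (lookup-++ˡ A A' i)))
                (ΣF-cong l (λ i → cong₂ (λ a B → a *ᶠ B j) (lookup-++ʳ κ μ i) (lookup-++ʳ A A' i))))

  combine-cong : ∀ {n m} (A : Fin m → Vec p n) {κ μ : Vec p m} → κ ≗ μ → combine A κ ≗ combine A μ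
  combine-cong {m = m} A κ≗μ j = ΣF-cong m (λ i → cong (_*ᶠ A i j) (κ≗μ i))

  module _ {n R : ℕ} (M : Fin n → Fin n → F p) (f : Fin R → Fin n) (indep : ColsIndep p M f) where

    embed : Vec p R → Vec p n
    embed z j = ΣF p R (λ k → δ j (f k) *ᶠ z k)

    *ᴹ-embed : ∀ z i → (M *ᴹ embed z) i ≡ ΣF p R (λ k → z k *ᶠ M i (f k))
    *ᴹ-embed z i = begin
      ΣF p n (λ j → M i j *ᶠ ΣF p R (λ k → δ j (f k) *ᶠ z k))     ≡⟨ ΣF-cong n (λ j → sym (ΣF-*ˡ R (M i j) _)) ⟩
      ΣF p n (λ j → ΣF p R (λ k → M i j *ᶠ (δ j (f k) *ᶠ z k)))    ≡⟨ ΣF-cong n (λ j → ΣF-cong R (λ k → 𝔽*.x∙yz≈y∙xz (M i j) (δ j (f k)) (z k))) ⟩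
      ΣF p n (λ j → ΣF p R (λ k → δ j (f k) *ᶠ (M i j *ᶠ z k)))    ≡⟨ ΣF-comm n R _ ⟩
      ΣF p R (λ k → ΣF p n (λ j → δ j (f k) *ᶠ (M i j *ᶠ z k)))    ≡⟨ ΣF-cong R (λ k → ΣF-δ n (f k) (λ j → M i j *ᶠ z k)) ⟩
      ΣF p R (λ k → M i (f k) *ᶠ z k)                              ≡⟨ ΣF-cong R (λ k → 𝔽.*-comm (M i (f k)) (z k)) ⟩
      ΣF p R (λ k → z k *ᶠ M i (f k))                              ∎
      where open ≡-Reasoning

    -- a column combination determines its coefficients, so within a fibre of M, h + embed z pins z down
    embed-unique : ∀ (h t : Vec p n) (z z' : Vec p R) →
                   (M *ᴹ (h +ᵛ embed z) =ᵛ t) ≡ true → (M *ᴹ (h +ᵛ embed z') =ᵛ t) ≡ true → z ≗ z'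
    embed-unique h t z z' ∈fibre ∈fibre' k =
      𝔽Group.x∙y⁻¹≈ε⇒x≈y (z k) (z' k) (indep (λ k → z k +ᶠ -ᶠ z' k) combination≡0 k)
      where
      open ≡-Reasoning
      same-image : ∀ i → (M *ᴹ embed z) i ≡ (M *ᴹ embed z') i
      same-image i = 𝔽Quasigroup.cancelˡ ((M *ᴹ h) i) _ _ (begin
        (M *ᴹ h) i +ᶠ (M *ᴹ embed z) i    ≡⟨ *ᴹ-+ M h (embed z) i ⟨
        (M *ᴹ (h +ᵛ embed z)) i           ≡⟨ =ᵛ-sound ∈fibre i ⟩
        t i                               ≡⟨ =ᵛ-sound ∈fibre' i ⟨
        (M *ᴹ (h +ᵛ embed z')) i          ≡⟨ *ᴹ-+ M h (embed z') i ⟩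
        (M *ᴹ h) i +ᶠ (M *ᴹ embed z') i   ∎)
      combination≡0 : ∀ i → ΣF p R (λ k → (z k +ᶠ -ᶠ z' k) *ᶠ M i (f k)) ≡ 0ᶠ
      combination≡0 i = begin
        ΣF p R (λ k → (z k +ᶠ -ᶠ z' k) *ᶠ M i (f k))
          ≡⟨ ΣF-cong R (λ k → trans (𝔽.distribʳ (M i (f k)) (z k) (-ᶠ z' k))
                                    (cong (z k *ᶠ M i (f k) +ᶠ_) (sym (𝔽Ring.-‿distribˡ-* (z' k) (M i (f k)))))) ⟩
        ΣF p R (λ k → z k *ᶠ M i (f k) +ᶠ -ᶠ (z' k *ᶠ M i (f k)))
          ≡⟨ trans (ΣF-+ R _ _) (cong (ΣF p R (λ k → z k *ᶠ M i (f k)) +ᶠ_) (ΣF-neg R _)) ⟩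
        ΣF p R (λ k → z k *ᶠ M i (f k)) +ᶠ -ᶠ ΣF p R (λ k → z' k *ᶠ M i (f k))
          ≡⟨ cong₂ (λ a b → a +ᶠ -ᶠ b) (*ᴹ-embed z i) (*ᴹ-embed z' i) ⟨
        (M *ᴹ embed z) i +ᶠ -ᶠ (M *ᴹ embed z') i
          ≡⟨ 𝔽Group.x≈y⇒x∙y⁻¹≈ε (same-image i) ⟩
        0ᶠ ∎

    -- translating the fibre by the p ^ R vectors embed z gives disjoint copies inside F^n
    fibre-bound : ∀ t → sumH p n (λ h → 𝟙 p (M *ᴹ h =ᵛ t)) * p ^ R ≤ p ^ n
    fibre-bound t = begin
      sumH p n (λ h → 𝟙 p (M *ᴹ h =ᵛ t)) * p ^ R
        ≡⟨ trans (ℕₚ.*-comm _ (p ^ R)) (sym (sumH-const R _)) ⟩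
      sumH p R (λ z → sumH p n (λ h → 𝟙 p (M *ᴹ h =ᵛ t)))
        ≡⟨ sumH-cong R (λ z → sumH-translate n (λ h → 𝟙 p (M *ᴹ h =ᵛ t)) (embed z)
                                 (λ h≗w → cong (𝟙 p) (=ᵛ-cong (*ᴹ-cong M h≗w) (λ _ → refl)))) ⟨
      sumH p R (λ z → sumH p n (λ h → 𝟙 p (M *ᴹ (h +ᵛ embed z) =ᵛ t)))
        ≡⟨ sumH-comm R n _ ⟩
      sumH p n (λ h → sumH p R (λ z → 𝟙 p (M *ᴹ (h +ᵛ embed z) =ᵛ t)))
        ≤⟨ sumH-mono n (λ h → sumH≤1 R _ (λ z → 𝟙≤1 _)
                                 (λ z z' 0<z 0<z' → embed-unique h t z z' (𝟙-positive 0<z) (𝟙-positive 0<z'))) ⟩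
      sumH p n (λ _ → 1)
        ≡⟨ trans (sumH-const n 1) (ℕₚ.*-identityʳ (p ^ n)) ⟩
      p ^ n ∎
      where open ℕₚ.≤-Reasoning

  -- Quadratic polynomials

  bform-cong : ∀ {n} (M : Fin n → Fin n → F p) {x x' y y' : Vec p n} → x ≗ x' → y ≗ y' → bform p M x y ≡ bform p M x' y'
  bform-cong {n} M x≗x' y≗y' = ΣF-cong n (λ i → ΣF-cong n (λ j → cong₂ (λ a b → (M i j *ᶠ a) *ᶠ b) (x≗x' i) (y≗y' j)))

  bform-+ˡ : ∀ {n} (M : Fin n → Fin n → F p) (x y w : Vec p n) → bform p M (x +ᵛ y) w ≡ bform p M x w +ᶠ bform p M y w
  bform-+ˡ {n} M x y w = trans (ΣF-cong n (λ i → trans (ΣF-cong n (λ j →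
      trans (cong (_*ᶠ w j) (𝔽.distribˡ (M i j) (x i) (y i))) (𝔽.distribʳ (w j) (M i j *ᶠ x i) (M i j *ᶠ y i))))
                                 (ΣF-+ n (λ j → (M i j *ᶠ x i) *ᶠ w j) (λ j → (M i j *ᶠ y i) *ᶠ w j))))
             (ΣF-+ n (λ i → ΣF p n (λ j → (M i j *ᶠ x i) *ᶠ w j)) (λ i → ΣF p n (λ j → (M i j *ᶠ y i) *ᶠ w j)))

  bform-+ʳ : ∀ {n} (M : Fin n → Fin n → F p) (x w z : Vec p n) → bform p M x (w +ᵛ z) ≡ bform p M x w +ᶠ bform p M x z
  bform-+ʳ {n} M x w z = trans (ΣF-cong n (λ i → trans (ΣF-cong n (λ j → 𝔽.distribˡ (M i j *ᶠ x i) (w j) (z j))) (ΣF-+ n _ _))) (ΣF-+ n _ _)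

  private
    +-regroup₁ : ∀ (Bzz Bzy Byz Byy ℓz ℓy c : F p) →
      ((Bzz +ᶠ Bzy) +ᶠ (Byz +ᶠ Byy)) +ᶠ (ℓz +ᶠ ℓy) +ᶠ c ≡ ((Bzz +ᶠ ℓz) +ᶠ c) +ᶠ ((Bzy +ᶠ Byz) +ᶠ (Byy +ᶠ ℓy))
    +-regroup₁ = solve-∀ 𝔽-almostCommutativeRing

    +-regroup₂ : ∀ (Bxy Byy Byx ℓy : F p) →
      ((Bxy +ᶠ Byy) +ᶠ (Byx +ᶠ Byy)) +ᶠ (Byy +ᶠ ℓy) ≡ ((Bxy +ᶠ Byx) +ᶠ (Byy +ᶠ ℓy)) +ᶠ (Byy +ᶠ Byy)
    +-regroup₂ = solve-∀ 𝔽-almostCommutativeRing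

    +-regroup₃ : ∀ (Q₁ I T Q₀ : F p) → (Q₁ +ᶠ (I +ᶠ T)) +ᶠ Q₀ ≡ (Q₁ +ᶠ (Q₀ +ᶠ I)) +ᶠ T
    +-regroup₃ = solve-∀ 𝔽-almostCommutativeRing

    +-regroup₄ : ∀ (Bxx ℓx c Bxu Bux Buu ℓu : F p) →
      ((Bxx +ᶠ ℓx) +ᶠ c) +ᶠ ((Bxu +ᶠ Bux) +ᶠ (Buu +ᶠ ℓu)) ≡ Bxx +ᶠ (((ℓx +ᶠ Bxu) +ᶠ Bux) +ᶠ ((Buu +ᶠ ℓu) +ᶠ c))
    +-regroup₄ = solve-∀ 𝔽-almostCommutativeRing

  private
    +-regroup₅ : ∀ (a P b R S : F p) → (a +ᶠ P) +ᶠ (b +ᶠ (R +ᶠ S)) ≡ (a +ᶠ b) +ᶠ ((P +ᶠ R) +ᶠ S)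
    +-regroup₅ = solve-∀ 𝔽-almostCommutativeRing

  module _ {n : ℕ} (q : QuadPoly p n) where
    open QuadPoly q

    B[_,_] : Vec p n → Vec p n → F p
    B[ x , y ] = bform p B x y

    evalQ-cong : ∀ {x y : Vec p n} → x ≗ y → evalQ p q x ≡ evalQ p q y
    evalQ-cong x≗y = cong (_+ᶠ c) (cong₂ _+ᶠ_ (bform-cong B x≗y x≗y) (dot-congʳ ℓ x≗y))

    evalQ-expand : ∀ x → evalQ p q x ≡ B[ x , x ] +ᶠ (dot ℓ x +ᶠ c)
    evalQ-expand x = 𝔽.+-assoc _ _ _

    increment : Vec p n → Vec p n → F p
    increment z y = (B[ z , y ] +ᶠ B[ y , z ]) +ᶠ (B[ y , y ] +ᶠ dot ℓ y)

    evalQ-increment : ∀ z y → evalQ p q (z +ᵛ y) ≡ evalQ p q z +ᶠ increment z y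
    evalQ-increment z y = begin
      (B[ z +ᵛ y , z +ᵛ y ] +ᶠ dot ℓ (z +ᵛ y)) +ᶠ c
        ≡⟨ cong (_+ᶠ c) (cong₂ _+ᶠ_ (trans (bform-+ˡ B z y (z +ᵛ y)) (cong₂ _+ᶠ_ (bform-+ʳ B z z y) (bform-+ʳ B y z y))) (dot-+ʳ ℓ z y)) ⟩
      ((B[ z , z ] +ᶠ B[ z , y ]) +ᶠ (B[ y , z ] +ᶠ B[ y , y ])) +ᶠ (dot ℓ z +ᶠ dot ℓ y) +ᶠ c
        ≡⟨ +-regroup₁ B[ z , z ] B[ z , y ] B[ y , z ] B[ y , y ] (dot ℓ z) (dot ℓ y) c ⟩
      evalQ p q z +ᶠ increment z y ∎
      where open ≡-Reasoning

    increment-shift : ∀ x y → increment (x +ᵛ y) y ≡ increment x y +ᶠ (B[ y , y ] +ᶠ B[ y , y ])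
    increment-shift x y = trans
      (cong (_+ᶠ (B[ y , y ] +ᶠ dot ℓ y)) (cong₂ _+ᶠ_ (bform-+ˡ B x y y) (bform-+ʳ B y x y)))
      (+-regroup₂ B[ x , y ] B[ y , y ] B[ y , x ] (dot ℓ y))

    evalQ-second-difference : ∀ x y →
      evalQ p q ((x +ᵛ y) +ᵛ y) +ᶠ evalQ p q x ≡ (evalQ p q (x +ᵛ y) +ᶠ evalQ p q (x +ᵛ y)) +ᶠ (B[ y , y ] +ᶠ B[ y , y ])
    evalQ-second-difference x y = begin
      evalQ p q ((x +ᵛ y) +ᵛ y) +ᶠ evalQ p q x
        ≡⟨ cong (_+ᶠ evalQ p q x) (trans (evalQ-increment (x +ᵛ y) y) (cong (evalQ p q (x +ᵛ y) +ᶠ_) (increment-shift x y))) ⟩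
      (evalQ p q (x +ᵛ y) +ᶠ (increment x y +ᶠ (B[ y , y ] +ᶠ B[ y , y ]))) +ᶠ evalQ p q x
        ≡⟨ +-regroup₃ (evalQ p q (x +ᵛ y)) (increment x y) (B[ y , y ] +ᶠ B[ y , y ]) (evalQ p q x) ⟩
      (evalQ p q (x +ᵛ y) +ᶠ (evalQ p q x +ᶠ increment x y)) +ᶠ (B[ y , y ] +ᶠ B[ y , y ])
        ≡⟨ cong (λ e → (evalQ p q (x +ᵛ y) +ᶠ e) +ᶠ (B[ y , y ] +ᶠ B[ y , y ])) (evalQ-increment x y) ⟨
      (evalQ p q (x +ᵛ y) +ᶠ evalQ p q (x +ᵛ y)) +ᶠ (B[ y , y ] +ᶠ B[ y , y ]) ∎
      where open ≡-Reasoning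

    linear-part : Vec p n → Vec p n
    linear-part u j = ℓ j +ᶠ ΣF p n (λ k → (B j k +ᶠ B k j) *ᶠ u k)

    dot-linear-part : ∀ u x → dot (linear-part u) x ≡ (dot ℓ x +ᶠ B[ x , u ]) +ᶠ B[ u , x ]
    dot-linear-part u x = begin
      ΣF p n (λ j → (ℓ j +ᶠ ΣF p n (λ k → (B j k +ᶠ B k j) *ᶠ u k)) *ᶠ x j)
        ≡⟨ trans (ΣF-cong n (λ j → 𝔽.distribʳ (x j) (ℓ j) _)) (ΣF-+ n _ _) ⟩
      dot ℓ x +ᶠ ΣF p n (λ j → ΣF p n (λ k → (B j k +ᶠ B k j) *ᶠ u k) *ᶠ x j)
        ≡⟨ cong (dot ℓ x +ᶠ_) symmetrised ⟩
      dot ℓ x +ᶠ (B[ x , u ] +ᶠ B[ u , x ])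
        ≡⟨ 𝔽.+-assoc _ _ _ ⟨
      (dot ℓ x +ᶠ B[ x , u ]) +ᶠ B[ u , x ] ∎
      where
      open ≡-Reasoning
      split-term : ∀ j k → ((B j k +ᶠ B k j) *ᶠ u k) *ᶠ x j ≡ (B j k *ᶠ x j) *ᶠ u k +ᶠ (B k j *ᶠ u k) *ᶠ x j
      split-term j k = trans (cong (_*ᶠ x j) (𝔽.distribʳ (u k) (B j k) (B k j)))
                             (trans (𝔽.distribʳ (x j) (B j k *ᶠ u k) (B k j *ᶠ u k))
                                    (cong (_+ᶠ (B k j *ᶠ u k) *ᶠ x j) (𝔽*.xy∙z≈xz∙y (B j k) (u k) (x j))))
      symmetrised : ΣF p n (λ j → ΣF p n (λ k → (B j k +ᶠ B k j) *ᶠ u k) *ᶠ x j) ≡ B[ x , u ] +ᶠ B[ u , x ]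
      symmetrised = begin
        ΣF p n (λ j → ΣF p n (λ k → (B j k +ᶠ B k j) *ᶠ u k) *ᶠ x j)
          ≡⟨ ΣF-cong n (λ j → trans (sym (ΣF-*ʳ n _ (x j))) (trans (ΣF-cong n (split-term j)) (ΣF-+ n _ _))) ⟩
        ΣF p n (λ j → ΣF p n (λ k → (B j k *ᶠ x j) *ᶠ u k) +ᶠ ΣF p n (λ k → (B k j *ᶠ u k) *ᶠ x j))
          ≡⟨ trans (ΣF-+ n _ _) (cong (B[ x , u ] +ᶠ_) (ΣF-comm n n (λ j k → (B k j *ᶠ u k) *ᶠ x j))) ⟩
        B[ x , u ] +ᶠ B[ u , x ] ∎

    evalQ-translate : ∀ x u → evalQ p q (x +ᵛ u) ≡ B[ x , x ] +ᶠ (dot (linear-part u) x +ᶠ evalQ p q u)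
    evalQ-translate x u = begin
      evalQ p q (x +ᵛ u)
        ≡⟨ evalQ-increment x u ⟩
      ((B[ x , x ] +ᶠ dot ℓ x) +ᶠ c) +ᶠ ((B[ x , u ] +ᶠ B[ u , x ]) +ᶠ (B[ u , u ] +ᶠ dot ℓ u))
        ≡⟨ +-regroup₄ B[ x , x ] (dot ℓ x) c B[ x , u ] B[ u , x ] B[ u , u ] (dot ℓ u) ⟩
      B[ x , x ] +ᶠ (((dot ℓ x +ᶠ B[ x , u ]) +ᶠ B[ u , x ]) +ᶠ ((B[ u , u ] +ᶠ dot ℓ u) +ᶠ c))
        ≡⟨ cong₂ (λ a b → B[ x , x ] +ᶠ (a +ᶠ b)) (dot-linear-part u x) refl ⟨
      B[ x , x ] +ᶠ (dot (linear-part u) x +ᶠ evalQ p q u) ∎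
      where open ≡-Reasoning

  module _ {n d : ℕ} (Q : Fin d → QuadPoly p n) where
    open QuadPoly

    polar : Vec p d → Fin n → Fin n → F p
    polar κ j k = ΣF p d (λ i → κ i *ᶠ (B (Q i) j k +ᶠ B (Q i) k j))

    linear-comb : Vec p d → Vec p n
    linear-comb κ j = ΣF p d (λ i → κ i *ᶠ ℓ (Q i) j)

    comb-linear-part : ∀ (κ : Vec p d) u j →
      ΣF p d (λ i → κ i *ᶠ linear-part (Q i) u j) ≡ linear-comb κ j +ᶠ (polar κ *ᴹ u) j
    comb-linear-part κ u j = begin
      ΣF p d (λ i → κ i *ᶠ (ℓ (Q i) j +ᶠ ΣF p n (λ k → (B (Q i) j k +ᶠ B (Q i) k j) *ᶠ u k)))
        ≡⟨ trans (ΣF-cong d (λ i → 𝔽.distribˡ (κ i) _ _)) (ΣF-+ d _ _) ⟩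
      linear-comb κ j +ᶠ ΣF p d (λ i → κ i *ᶠ ΣF p n (λ k → (B (Q i) j k +ᶠ B (Q i) k j) *ᶠ u k))
        ≡⟨ cong (linear-comb κ j +ᶠ_) (begin
          ΣF p d (λ i → κ i *ᶠ ΣF p n (λ k → (B (Q i) j k +ᶠ B (Q i) k j) *ᶠ u k))
            ≡⟨ ΣF-cong d (λ i → trans (sym (ΣF-*ˡ n (κ i) _)) (ΣF-cong n (λ k → sym (𝔽.*-assoc (κ i) _ (u k))))) ⟩
          ΣF p d (λ i → ΣF p n (λ k → (κ i *ᶠ (B (Q i) j k +ᶠ B (Q i) k j)) *ᶠ u k))
            ≡⟨ ΣF-comm d n _ ⟩
          ΣF p n (λ k → ΣF p d (λ i → (κ i *ᶠ (B (Q i) j k +ᶠ B (Q i) k j)) *ᶠ u k))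
            ≡⟨ ΣF-cong n (λ k → ΣF-*ʳ d _ (u k)) ⟩
          (polar κ *ᴹ u) j ∎) ⟩
      linear-comb κ j +ᶠ (polar κ *ᴹ u) j ∎
      where open ≡-Reasoning

    polar-+ : ∀ (κ μ : Vec p d) h j → (polar κ *ᴹ h) j +ᶠ (polar μ *ᴹ h) j ≡ (polar (κ +ᵛ μ) *ᴹ h) j
    polar-+ κ μ h j = trans (sym (ΣF-+ n _ _)) (ΣF-cong n (λ k →
      trans (sym (𝔽.distribʳ (h k) (polar κ j k) (polar μ j k)))
            (cong (_*ᶠ h k) (trans (sym (ΣF-+ d _ _)) (ΣF-cong d (λ i → sym (𝔽.distribʳ _ (κ i) (μ i))))))))

    polar-zero : ∀ (ν : Vec p d) → (∀ i → ν i ≡ 0ᶠ) → ∀ h j → (polar ν *ᴹ h) j ≡ 0ᶠ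
    polar-zero ν ν≡0 h j = trans (ΣF-cong n (λ k → trans (cong (_*ᶠ h k) polar≡0) (𝔽.zeroˡ (h k)))) (ΣF-zero n)
      where
      polar≡0 : ∀ {k} → polar ν j k ≡ 0ᶠ
      polar≡0 = trans (ΣF-cong d (λ i → trans (cong (_*ᶠ _) (ν≡0 i)) (𝔽.zeroˡ _))) (ΣF-zero d)

  module _ (p-odd : p % 2 ≡ 1) where

    half+half≡1 : half p +ᶠ half p ≡ 1ᶠ
    half+half≡1 = mod-cong (begin
      (toℕ (half p) + toℕ (half p)) % p     ≡⟨ +-congₚ (toℕ-mod (suc p / 2)) (toℕ-mod (suc p / 2)) ⟩
      (suc p / 2 + suc p / 2) % p           ≡⟨ cong (_% p) halves ⟩
      (1 + p) % p                           ≡⟨ [m+n]%n≡m%n 1 p ⟩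
      1 % p                                 ∎)
      where
      open ≡-Reasoning
      halves : suc p / 2 + suc p / 2 ≡ suc p
      halves = sym (trans (m≡m%n+[m/n]*n (suc p) 2)
        (cong₂ _+_ (trans (%-distribˡ-+ 1 p 2) (cong (λ r → (1 + r) % 2) p-odd))
                   (trans (ℕₚ.*-comm (suc p / 2) 2) (cong (suc p / 2 +_) (ℕₚ.+-identityʳ _)))))

    half-double : ∀ x → half p *ᶠ (x +ᶠ x) ≡ x
    half-double x = begin
      half p *ᶠ (x +ᶠ x)              ≡⟨ 𝔽.distribˡ (half p) x x ⟩
      half p *ᶠ x +ᶠ half p *ᶠ x      ≡⟨ 𝔽.distribʳ x (half p) (half p) ⟨
      (half p +ᶠ half p) *ᶠ x         ≡⟨ cong (_*ᶠ x) half+half≡1 ⟩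
      1ᶠ *ᶠ x                         ≡⟨ 𝔽.*-identityˡ x ⟩
      x                               ∎
      where open ≡-Reasoning

    double-injective : ∀ {x y} → x +ᶠ x ≡ y +ᶠ y → x ≡ y
    double-injective {x} {y} 2x≡2y = trans (sym (half-double x)) (trans (cong (half p *ᶠ_) 2x≡2y) (half-double y))

    solve-double : ∀ {x a b} → (x +ᶠ x) +ᶠ b ≡ a → x ≡ half p *ᶠ (a +ᶠ -ᶠ b)
    solve-double {x} {a} {b} 2x+b≡a = trans (sym (half-double x))
      (cong (half p *ᶠ_) (trans (sym (𝔽Group.//-rightDividesʳ b (x +ᶠ x))) (cong (_+ᶠ -ᶠ b) 2x+b≡a)))

    module _ {n d : ℕ} (Q : Fin d → QuadPoly p n) (κ : Vec p d) where

      symmetric-part : Fin n → Fin n → F p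
      symmetric-part = symm p (combB p Q κ)

      polar≡2·symmetric-part : ∀ j k → polar Q κ j k ≡ symmetric-part j k +ᶠ symmetric-part j k
      polar≡2·symmetric-part j k = begin
        polar Q κ j k
          ≡⟨ trans (ΣF-cong d (λ i → 𝔽.distribˡ (κ i) _ _)) (ΣF-+ d _ _) ⟩
        combB p Q κ j k +ᶠ combB p Q κ k j
          ≡⟨ 𝔽.*-identityˡ _ ⟨
        1ᶠ *ᶠ (combB p Q κ j k +ᶠ combB p Q κ k j)
          ≡⟨ cong (_*ᶠ (combB p Q κ j k +ᶠ combB p Q κ k j)) half+half≡1 ⟨
        (half p +ᶠ half p) *ᶠ (combB p Q κ j k +ᶠ combB p Q κ k j)
          ≡⟨ 𝔽.distribʳ _ (half p) (half p) ⟩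
        symmetric-part j k +ᶠ symmetric-part j k ∎
        where open ≡-Reasoning

      polar-*ᴹ : ∀ h j → (polar Q κ *ᴹ h) j ≡ (symmetric-part *ᴹ h) j +ᶠ (symmetric-part *ᴹ h) j
      polar-*ᴹ h j = trans (ΣF-cong n (λ k → trans (cong (_*ᶠ h k) (polar≡2·symmetric-part j k))
                                                   (𝔽.distribʳ (h k) (symmetric-part j k) (symmetric-part j k))))
                           (ΣF-+ n (λ k → symmetric-part j k *ᶠ h k) (λ k → symmetric-part j k *ᶠ h k))

  -- Affine equations and systems

  private
    distrib-regroup : ∀ (β c a t : F p) → β *ᶠ a +ᶠ (c *ᶠ a +ᶠ t) ≡ (c +ᶠ β) *ᶠ a +ᶠ t
    distrib-regroup β c a t = begin
      β *ᶠ a +ᶠ (c *ᶠ a +ᶠ t)   ≡⟨ 𝔽.+-assoc (β *ᶠ a) (c *ᶠ a) t ⟨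
      (β *ᶠ a +ᶠ c *ᶠ a) +ᶠ t   ≡⟨ cong (_+ᶠ t) (𝔽.+-comm (β *ᶠ a) (c *ᶠ a)) ⟩
      (c *ᶠ a +ᶠ β *ᶠ a) +ᶠ t   ≡⟨ cong (_+ᶠ t) (𝔽.distribʳ a c β) ⟨
      (c +ᶠ β) *ᶠ a +ᶠ t        ∎
      where open ≡-Reasoning

    *-regroup : ∀ (c i u : F p) → c *ᶠ (i *ᶠ u) ≡ (i *ᶠ c) *ᶠ u
    *-regroup c i u = trans (sym (𝔽.*-assoc c i u)) (cong (_*ᶠ u) (𝔽.*-comm c i))

  affine-normalise : ∀ {α β a t t'} → α *ᶠ a +ᶠ t ≡ β *ᶠ a +ᶠ t' → (α +ᶠ -ᶠ β) *ᶠ a +ᶠ t ≡ t'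
  affine-normalise {α} {β} {a} {t} {t'} e = 𝔽Quasigroup.cancelˡ (β *ᶠ a) _ _ (begin
    β *ᶠ a +ᶠ ((α +ᶠ -ᶠ β) *ᶠ a +ᶠ t)   ≡⟨ distrib-regroup β (α +ᶠ -ᶠ β) a t ⟩
    ((α +ᶠ -ᶠ β) +ᶠ β) *ᶠ a +ᶠ t        ≡⟨ cong (λ x → x *ᶠ a +ᶠ t) (𝔽Group.//-rightDividesˡ β α) ⟩
    α *ᶠ a +ᶠ t                         ≡⟨ e ⟩
    β *ᶠ a +ᶠ t'                        ∎)
    where open ≡-Reasoning

  affine-denormalise : ∀ {α β a t t'} → (α +ᶠ -ᶠ β) *ᶠ a +ᶠ t ≡ t' → α *ᶠ a +ᶠ t ≡ β *ᶠ a +ᶠ t'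
  affine-denormalise {α} {β} {a} {t} {t'} e = begin
    α *ᶠ a +ᶠ t                         ≡⟨ cong (λ x → x *ᶠ a +ᶠ t) (𝔽Group.//-rightDividesˡ β α) ⟨
    ((α +ᶠ -ᶠ β) +ᶠ β) *ᶠ a +ᶠ t        ≡⟨ distrib-regroup β (α +ᶠ -ᶠ β) a t ⟨
    β *ᶠ a +ᶠ ((α +ᶠ -ᶠ β) *ᶠ a +ᶠ t)   ≡⟨ cong (β *ᶠ a +ᶠ_) e ⟩
    β *ᶠ a +ᶠ t'                        ∎
    where open ≡-Reasoning

  module _ (prime : Prime p) where

    ∣toℕ⇒≡0ᶠ : ∀ {a} → p ∣ toℕ a → a ≡ 0ᶠ
    ∣toℕ⇒≡0ᶠ {a} p∣a = toℕ-≡ₚ-injective (trans (n∣m⇒m%n≡0 _ p p∣a) (trans (sym 0%p≡0) (sym (toℕ-mod 0))))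

    *ᶠ-zero-product : ∀ a b → a *ᶠ b ≡ 0ᶠ → a ≡ 0ᶠ ⊎ b ≡ 0ᶠ
    *ᶠ-zero-product a b ab≡0 with euclidsLemma (toℕ a) (toℕ b) prime p∣ab
      where
      p∣ab : p ∣ toℕ a * toℕ b
      p∣ab = m%n≡0⇒n∣m _ p (trans (sym (toℕ-mod (toℕ a * toℕ b)))
                             (trans (cong (λ x → toℕ x % p) ab≡0) (trans (toℕ-mod 0) 0%p≡0)))
    ... | inj₁ p∣a = inj₁ (∣toℕ⇒≡0ᶠ p∣a)
    ... | inj₂ p∣b = inj₂ (∣toℕ⇒≡0ᶠ p∣b)

    *ᶠ-inverse : ∀ a → a ≢ 0ᶠ → ∃ λ b → b *ᶠ a ≡ 1ᶠ
    *ᶠ-inverse a a≢0 with coprime-Bézout (prime⇒coprime prime {{ℕ.≢-nonZero toℕa≢0}} (toℕ<n a))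
      where
      toℕa≢0 : toℕ a ≢ 0
      toℕa≢0 toℕa≡0 = a≢0 (toℕ-≡ₚ-injective (trans (cong (_% p) toℕa≡0) (sym (toℕ-mod 0))))
    ... | Bézout.-+ x y 1+xp≡ya = y mod p , mod-cong
            (trans (*-congₚ (toℕ-mod y) refl) (trans (cong (_% p) (sym 1+xp≡ya)) ([m+kn]%n≡m%n 1 x p)))
    ... | Bézout.+- x y 1+ya≡xp = -ᶠ (y mod p) , (begin
            -ᶠ (y mod p) *ᶠ a      ≡⟨ 𝔽Ring.-‿distribˡ-* (y mod p) a ⟨
            -ᶠ ((y mod p) *ᶠ a)    ≡⟨ cong -ᶠ_ (𝔽Group.inverseʳ-unique 1ᶠ _ 1+ya≡0) ⟩
            -ᶠ (-ᶠ 1ᶠ)             ≡⟨ 𝔽Group.⁻¹-involutive 1ᶠ ⟩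
            1ᶠ                     ∎)
      where
      open ≡-Reasoning
      1+ya≡0 : 1ᶠ +ᶠ (y mod p) *ᶠ a ≡ 0ᶠ
      1+ya≡0 = mod-cong (trans (+-congₚ (toℕ-mod 1) (trans (toℕ-mod _) (*-congₚ (toℕ-mod y) refl)))
                          (trans (cong (_% p) 1+ya≡xp) (trans (m*n%n≡0 x p) (sym (m*n%n≡0 0 p)))))

    affine-unique : ∀ {α β a b t t'} → α ≢ β →
                    α *ᶠ a +ᶠ t ≡ β *ᶠ a +ᶠ t' → α *ᶠ b +ᶠ t ≡ β *ᶠ b +ᶠ t' → a ≡ b
    affine-unique {α} {β} {a} {b} {t} {t'} α≢β ea eb =
      [ (λ α-β≡0 → ⊥-elim (α≢β (𝔽Group.x∙y⁻¹≈ε⇒x≈y α β α-β≡0))) , 𝔽Group.x∙y⁻¹≈ε⇒x≈y a b ]′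
        (*ᶠ-zero-product c (a +ᶠ -ᶠ b) c[a-b]≡0)
      where
      open ≡-Reasoning
      c = α +ᶠ -ᶠ β
      ca≡cb : c *ᶠ a ≡ c *ᶠ b
      ca≡cb = 𝔽Quasigroup.cancelʳ t (c *ᶠ a) (c *ᶠ b) (trans (affine-normalise {α} {β} ea) (sym (affine-normalise {α} {β} eb)))
      c[a-b]≡0 : c *ᶠ (a +ᶠ -ᶠ b) ≡ 0ᶠ
      c[a-b]≡0 = begin
        c *ᶠ (a +ᶠ -ᶠ b)              ≡⟨ 𝔽Ring.x[y-z]≈xy-xz c a b ⟩
        c *ᶠ a +ᶠ -ᶠ (c *ᶠ b)         ≡⟨ cong (_+ᶠ -ᶠ (c *ᶠ b)) ca≡cb ⟩
        c *ᶠ b +ᶠ -ᶠ (c *ᶠ b)         ≡⟨ 𝔽.-‿inverseʳ (c *ᶠ b) ⟩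
        0ᶠ                            ∎

    affine-solvable : ∀ {α β} → α ≢ β → ∀ t t' → ∃ λ a → α *ᶠ a +ᶠ t ≡ β *ᶠ a +ᶠ t'
    affine-solvable {α} {β} α≢β t t' = i *ᶠ (t' +ᶠ -ᶠ t) , affine-denormalise {α} {β} (begin
      c *ᶠ (i *ᶠ (t' +ᶠ -ᶠ t)) +ᶠ t   ≡⟨ cong (_+ᶠ t) (*-regroup c i (t' +ᶠ -ᶠ t)) ⟩
      (i *ᶠ c) *ᶠ (t' +ᶠ -ᶠ t) +ᶠ t   ≡⟨ cong (λ x → x *ᶠ (t' +ᶠ -ᶠ t) +ᶠ t) ic≡1 ⟩
      1ᶠ *ᶠ (t' +ᶠ -ᶠ t) +ᶠ t         ≡⟨ cong (_+ᶠ t) (𝔽.*-identityˡ (t' +ᶠ -ᶠ t)) ⟩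
      (t' +ᶠ -ᶠ t) +ᶠ t               ≡⟨ 𝔽Group.//-rightDividesˡ t t' ⟩
      t'                              ∎)
      where
      open ≡-Reasoning
      c = α +ᶠ -ᶠ β
      inverse = *ᶠ-inverse c (α≢β ∘ 𝔽Group.x∙y⁻¹≈ε⇒x≈y α β)
      i = proj₁ inverse
      ic≡1 = proj₂ inverse

    affine-count : ∀ {α β} → α ≢ β → ∀ t t' → ∑[ a < p ] 𝟙 p (α *ᶠ a +ᶠ t =ᶠ β *ᶠ a +ᶠ t') ≡ 1
    affine-count {α} {β} α≢β t t' =
      trans (sum-single ℕₚ.+-0-monoid a₀ (λ a → 𝟙 p (α *ᶠ a +ᶠ t =ᶠ β *ᶠ a +ᶠ t'))
                        (λ a a≢a₀ → 𝟙[=ᶠ]-≢ (λ a-solves → a≢a₀ (affine-unique α≢β a-solves a₀-solves))))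
            (𝟙[=ᶠ]-≡ a₀-solves)
      where
      a₀ = proj₁ (affine-solvable α≢β t t')
      a₀-solves = proj₂ (affine-solvable α≢β t t')

    hyperplane-count : ∀ n (u u' : Vec p n) (s s' : F p) → (∃ λ j → u j ≢ u' j) →
                       sumH p n (λ x → 𝟙 p (dot u x +ᶠ s =ᶠ dot u' x +ᶠ s')) * p ≡ p ^ n
    hyperplane-count (suc n) u u' s s' (j , uⱼ≢u'ⱼ) = begin
      sumH p (suc n) (λ x → 𝟙 p (dot u x +ᶠ s =ᶠ dot u' x +ᶠ s')) * p
        ≡⟨ cong (_* p) (sumH-unfold n _ (λ x≗y →
             cong (𝟙 p) (cong₂ _=ᶠ_ (cong (_+ᶠ s) (dot-congʳ u x≗y)) (cong (_+ᶠ s') (dot-congʳ u' x≗y))))) ⟩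
      (∑[ a < p ] slice a) * p
        ≡⟨ by-coordinate j uⱼ≢u'ⱼ ⟩
      p ^ suc n ∎
      where
      open ≡-Reasoning
      u₀ = u Fin.zero
      u'₀ = u' Fin.zero
      u⁺ = u ∘ Fin.suc
      u'⁺ = u' ∘ Fin.suc
      slice : F p → ℕ
      slice a = sumH p n (λ v → 𝟙 p ((u₀ *ᶠ a +ᶠ dot u⁺ v) +ᶠ s =ᶠ (u'₀ *ᶠ a +ᶠ dot u'⁺ v) +ᶠ s'))
      equation : F p → Vec p n → ℕ
      equation a v = 𝟙 p (u₀ *ᶠ a +ᶠ (dot u⁺ v +ᶠ s) =ᶠ u'₀ *ᶠ a +ᶠ (dot u'⁺ v +ᶠ s'))
      by-coordinate : ∀ j → u j ≢ u' j → (∑[ a < p ] slice a) * p ≡ p ^ suc n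
      by-coordinate Fin.zero u₀≢u'₀ = begin
        (∑[ a < p ] slice a) * p
          ≡⟨ cong (_* p) (trans (ℕΣ.sum-cong-≗ {x = slice} {y = λ a → sumH p n (equation a)}
                                   (λ a → sumH-cong n (λ v → cong (𝟙 p) (cong₂ _=ᶠ_ (𝔽.+-assoc _ _ _) (𝔽.+-assoc _ _ _)))))
                                (∑-sumH n equation)) ⟩
        sumH p n (λ v → ∑[ a < p ] equation a v) * p
          ≡⟨ cong (_* p) (sumH-cong n (λ v → affine-count u₀≢u'₀ _ _)) ⟩
        sumH p n (λ _ → 1) * p
          ≡⟨ cong (_* p) (trans (sumH-const n 1) (ℕₚ.*-identityʳ (p ^ n))) ⟩
        p ^ n * p
          ≡⟨ ℕₚ.*-comm (p ^ n) p ⟩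
        p ^ suc n ∎
      by-coordinate (Fin.suc j) u⁺ⱼ≢u'⁺ⱼ = begin
        (∑[ a < p ] slice a) * p
          ≡⟨ ∑-*ʳ slice p ⟨
        ∑[ a < p ] (slice a * p)
          ≡⟨ ℕΣ.sum-cong-≗ {x = λ a → slice a * p} (λ a → trans
               (cong (_* p) (sumH-cong n (λ v → cong (𝟙 p) (cong₂ _=ᶠ_ (𝔽+.xy∙z≈y∙xz _ _ _) (𝔽+.xy∙z≈y∙xz _ _ _)))))
                                                         (hyperplane-count n u⁺ u'⁺ _ _ (j , u⁺ⱼ≢u'⁺ⱼ))) ⟩
        ∑[ a < p ] (p ^ n)
          ≡⟨ ∑-const p (p ^ n) ⟩
        p ^ suc n ∎

    -- an affine equation in x has p ^ n solutions if trivial and at most p ^ (n ∸ 1) otherwise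
    hyperplane-count-≤ : ∀ n (u u' : Vec p n) (s s' : F p) →
      sumH p n (λ x → 𝟙 p (dot u x +ᶠ s =ᶠ dot u' x +ᶠ s')) * p + 𝟙 p (u =ᵛ u') * p ^ n ≤ 𝟙 p (u =ᵛ u') * (p ^ n * p) + p ^ n
    hyperplane-count-≤ n u u' s s' with u =ᵛ u' in u=u'
    ... | true  = begin
      #solutions * p + 1 * p ^ n        ≤⟨ ℕₚ.+-mono-≤ (ℕₚ.*-monoˡ-≤ p #solutions≤) (ℕₚ.≤-reflexive (ℕₚ.*-identityˡ (p ^ n))) ⟩
      p ^ n * p + p ^ n            ≡⟨ cong (_+ p ^ n) (ℕₚ.*-identityˡ (p ^ n * p)) ⟨
      1 * (p ^ n * p) + p ^ n      ∎
      where
      open ℕₚ.≤-Reasoning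
      #solutions = sumH p n (λ x → 𝟙 p (dot u x +ᶠ s =ᶠ dot u' x +ᶠ s'))
      #solutions≤ : #solutions ≤ p ^ n
      #solutions≤ = subst (#solutions ≤_) (trans (sumH-const n 1) (ℕₚ.*-identityʳ (p ^ n))) (sumH-mono n (λ x → 𝟙≤1 _))
    ... | false = ℕₚ.≤-reflexive (trans (ℕₚ.+-identityʳ _) (hyperplane-count n u u' s s' (=ᵛ-false u=u')))

    hyperplane-count-≡ : ∀ n (u u' : Vec p n) →
      sumH p n (λ x → 𝟙 p (dot u x +ᶠ 0ᶠ =ᶠ dot u' x +ᶠ 0ᶠ)) * p + 𝟙 p (u =ᵛ u') * p ^ n ≡ 𝟙 p (u =ᵛ u') * (p ^ n * p) + p ^ n
    hyperplane-count-≡ n u u' with u =ᵛ u' in u=u'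
    ... | true  = trans (cong₂ _+_ (cong (_* p) all-solve) (ℕₚ.*-identityˡ (p ^ n)))
                        (cong (_+ p ^ n) (sym (ℕₚ.*-identityˡ (p ^ n * p))))
      where
      all-solve : sumH p n (λ x → 𝟙 p (dot u x +ᶠ 0ᶠ =ᶠ dot u' x +ᶠ 0ᶠ)) ≡ p ^ n
      all-solve = trans (sumH-cong n (λ x → 𝟙[=ᶠ]-≡ (cong (_+ᶠ 0ᶠ) (dot-congˡ (=ᵛ-sound u=u') x))))
                        (trans (sumH-const n 1) (ℕₚ.*-identityʳ (p ^ n)))
    ... | false = trans (ℕₚ.+-identityʳ _) (hyperplane-count n u u' 0ᶠ 0ᶠ (=ᵛ-false u=u'))

    module AffineSystem {n m : ℕ} (A A' : Fin m → Vec p n) (s s' : Fin m → F p) where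

      solutions : ℕ
      solutions = sumH p n (λ x → 𝟙 p (affine A s x =ᵛ affine A' s' x))

      annihilators : ℕ
      annihilators = sumH p m (λ l → 𝟙 p (combine A l =ᵛ combine A' l))

      -- Double count the pairs (x, l) with l · (A x + s) = l · (A' x + s'): an x contributes p ^ m if it
      -- solves the system and p ^ (m ∸ 1) otherwise, an l at most p ^ n if it annihilates A − A' and
      -- p ^ (n ∸ 1) otherwise.
      solutions-bound : 2 ≤ p → solutions * p ^ m ≤ annihilators * p ^ n
      solutions-bound 2≤p =
        double-count-≤ {pairs * p} {solutions * p ^ m} {annihilators * p ^ n} {p} {p ^ n * p ^ m} 2≤p by-x by-l
        where
        pairs-at : Vec p n → ℕ
        pairs-at x = sumH p m (λ l → 𝟙 p (dot (affine A s x) l +ᶠ 0ᶠ =ᶠ dot (affine A' s' x) l +ᶠ 0ᶠ))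
        solves : Vec p n → ℕ
        solves x = 𝟙 p (affine A s x =ᵛ affine A' s' x)
        pairs : ℕ
        pairs = sumH p n pairs-at
        by-x : pairs * p + solutions * p ^ m ≡ solutions * p ^ m * p + p ^ n * p ^ m
        by-x = begin
          pairs * p + solutions * p ^ m
            ≡⟨ cong₂ _+_ (sumH-*ʳ n pairs-at p) (sumH-*ʳ n solves (p ^ m)) ⟨
          sumH p n (λ x → pairs-at x * p) + sumH p n (λ x → solves x * p ^ m)
            ≡⟨ sumH-+ n (λ x → pairs-at x * p) (λ x → solves x * p ^ m) ⟨
          sumH p n (λ x → pairs-at x * p + solves x * p ^ m)
            ≡⟨ sumH-cong n (λ x → hyperplane-count-≡ m (affine A s x) (affine A' s' x)) ⟩
          sumH p n (λ x → solves x * (p ^ m * p) + p ^ m)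
            ≡⟨ trans (sumH-+ n (λ x → solves x * (p ^ m * p)) (λ _ → p ^ m)) (cong₂ _+_ (sumH-*ʳ n solves (p ^ m * p)) (sumH-const n (p ^ m))) ⟩
          solutions * (p ^ m * p) + p ^ n * p ^ m
            ≡⟨ cong (_+ p ^ n * p ^ m) (ℕₚ.*-assoc solutions (p ^ m) p) ⟨
          solutions * p ^ m * p + p ^ n * p ^ m ∎
          where open ≡-Reasoning
        hyperplane-at : Vec p m → ℕ
        hyperplane-at l = sumH p n (λ x → 𝟙 p (dot (combine A l) x +ᶠ dot s l =ᶠ dot (combine A' l) x +ᶠ dot s' l))
        annihilates : Vec p m → ℕ
        annihilates l = 𝟙 p (combine A l =ᵛ combine A' l)
        by-l : pairs * p + annihilators * p ^ n ≤ annihilators * p ^ n * p + p ^ n * p ^ m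
        by-l = begin
          pairs * p + annihilators * p ^ n
            ≡⟨ cong (λ c → c * p + annihilators * p ^ n) (trans (sumH-comm n m _)
                 (sumH-cong m (λ l → sumH-cong n (λ x → cong (𝟙 p) (cong₂ _=ᶠ_ (dot-affine A s x l) (dot-affine A' s' x l)))))) ⟩
          sumH p m hyperplane-at * p + annihilators * p ^ n
            ≡⟨ trans (sumH-+ m (λ l → hyperplane-at l * p) (λ l → annihilates l * p ^ n))
                     (cong₂ _+_ (sumH-*ʳ m hyperplane-at p) (sumH-*ʳ m annihilates (p ^ n))) ⟨
          sumH p m (λ l → hyperplane-at l * p + annihilates l * p ^ n)
            ≤⟨ sumH-mono m (λ l → hyperplane-count-≤ n (combine A l) (combine A' l) (dot s l) (dot s' l)) ⟩
          sumH p m (λ l → annihilates l * (p ^ n * p) + p ^ n)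
            ≡⟨ trans (sumH-+ m (λ l → annihilates l * (p ^ n * p)) (λ _ → p ^ n))
                     (cong₂ _+_ (sumH-*ʳ m annihilates (p ^ n * p)) (trans (sumH-const m (p ^ n)) (ℕₚ.*-comm (p ^ m) (p ^ n)))) ⟩
          annihilators * (p ^ n * p) + p ^ n * p ^ m
            ≡⟨ cong (_+ p ^ n * p ^ m) (ℕₚ.*-assoc annihilators (p ^ n) p) ⟨
          annihilators * p ^ n * p + p ^ n * p ^ m ∎
          where open ℕₚ.≤-Reasoning

    -- Collisions and the rank hypothesis

    module Collisions {n d : ℕ} (Q : Fin d → QuadPoly p n) where
      open QuadPoly

      values : Vec p n → Vec p d
      values x i = evalQ p (Q i) x

      collisions-at : Vec p n → Vec p n → Vec p n → ℕ
      collisions-at y y' h = sumH p n (λ x →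
        𝟙 p (values (h +ᵛ x) =ᵛ values x) * 𝟙 p (values ((h +ᵛ x) +ᵛ y') =ᵛ values (x +ᵛ y)))

      degenerate : Vec p n → Vec p n → Vec p n → Vec p d → Vec p d → Bool
      degenerate y y' h κ μ = (polar Q (κ +ᵛ μ) *ᴹ h +ᵛ polar Q μ *ᴹ y') =ᵛ polar Q μ *ᴹ y

      degenerate-pairs : Vec p n → Vec p n → Vec p n → ℕ
      degenerate-pairs y y' h = sumH p d (λ κ → sumH p d (λ μ → 𝟙 p (degenerate y y' h κ μ)))

      -- For fixed y, y', h both collision conditions are affine in x: the quadratic parts cancel.
      module CollisionSystem (y y' h : Vec p n) where
        Aₗ Aᵣ A'ₗ A'ᵣ : Fin d → Vec p n
        Aₗ i  = linear-part (Q i) h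
        Aᵣ i  = linear-part (Q i) (h +ᵛ y')
        A'ₗ i = ℓ (Q i)
        A'ᵣ i = linear-part (Q i) y
        sₗ s'ₗ : Vec p d
        sₗ = values h
        s'ₗ i = c (Q i)
        open AffineSystem (Aₗ ++ Aᵣ) (A'ₗ ++ A'ᵣ) (sₗ ++ values (h +ᵛ y')) (s'ₗ ++ values y) public

        first-block : ∀ x i → (values (h +ᵛ x) i =ᶠ values x i) ≡ (affine Aₗ sₗ x i =ᶠ affine A'ₗ s'ₗ x i)
        first-block x i = =ᶠ-cancelˡ (B[_,_] (Q i) x x)
          (trans (evalQ-cong (Q i) (λ k → 𝔽.+-comm (h k) (x k))) (evalQ-translate (Q i) x h)) (evalQ-expand (Q i) x)

        second-block : ∀ x i → (values ((h +ᵛ x) +ᵛ y') i =ᶠ values (x +ᵛ y) i)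
                             ≡ (affine Aᵣ (values (h +ᵛ y')) x i =ᶠ affine A'ᵣ (values y) x i)
        second-block x i = =ᶠ-cancelˡ (B[_,_] (Q i) x x)
          (trans (evalQ-cong (Q i) (λ k → 𝔽+.xy∙z≈y∙xz (h k) (x k) (y' k))) (evalQ-translate (Q i) x (h +ᵛ y')))
          (evalQ-translate (Q i) x y)

        solutions≡ : solutions ≡ collisions-at y y' h
        solutions≡ = sumH-cong n (λ x → trans (cong (𝟙 p) (begin
          affine (Aₗ ++ Aᵣ) (sₗ ++ values (h +ᵛ y')) x =ᵛ affine (A'ₗ ++ A'ᵣ) (s'ₗ ++ values y) x
            ≡⟨ =ᵛ-cong (affine-++ Aₗ Aᵣ sₗ (values (h +ᵛ y')) x) (affine-++ A'ₗ A'ᵣ s'ₗ (values y) x) ⟩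
          (affine Aₗ sₗ x ++ affine Aᵣ (values (h +ᵛ y')) x) =ᵛ (affine A'ₗ s'ₗ x ++ affine A'ᵣ (values y) x)
            ≡⟨ =ᵛ-++ (affine Aₗ sₗ x) (affine A'ₗ s'ₗ x) (affine Aᵣ (values (h +ᵛ y')) x) (affine A'ᵣ (values y) x) ⟩
          (affine Aₗ sₗ x =ᵛ affine A'ₗ s'ₗ x) ∧ (affine Aᵣ (values (h +ᵛ y')) x =ᵛ affine A'ᵣ (values y) x)
            ≡⟨ cong₂ _∧_ (allB-cong d (first-block x)) (allB-cong d (second-block x)) ⟨
          (values (h +ᵛ x) =ᵛ values x) ∧ (values ((h +ᵛ x) +ᵛ y') =ᵛ values (x +ᵛ y)) ∎))
          (𝟙-∧ (values (h +ᵛ x) =ᵛ values x) (values ((h +ᵛ x) +ᵛ y') =ᵛ values (x +ᵛ y))))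
          where open ≡-Reasoning

        combine-lhs : ∀ κ μ j → combine (Aₗ ++ Aᵣ) (κ ++ μ) j
          ≡ (linear-comb Q κ j +ᶠ linear-comb Q μ j) +ᶠ (polar Q (κ +ᵛ μ) *ᴹ h +ᵛ polar Q μ *ᴹ y') j
        combine-lhs κ μ j = begin
          combine (Aₗ ++ Aᵣ) (κ ++ μ) j
            ≡⟨ combine-++ Aₗ Aᵣ κ μ j ⟩
          combine Aₗ κ j +ᶠ combine Aᵣ μ j
            ≡⟨ cong₂ _+ᶠ_ (comb-linear-part Q κ h j)
                          (trans (comb-linear-part Q μ (h +ᵛ y') j) (cong (linear-comb Q μ j +ᶠ_) (*ᴹ-+ (polar Q μ) h y' j))) ⟩
          (linear-comb Q κ j +ᶠ (polar Q κ *ᴹ h) j) +ᶠ (linear-comb Q μ j +ᶠ ((polar Q μ *ᴹ h) j +ᶠ (polar Q μ *ᴹ y') j))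
            ≡⟨ +-regroup₅ (linear-comb Q κ j) ((polar Q κ *ᴹ h) j) (linear-comb Q μ j) ((polar Q μ *ᴹ h) j) ((polar Q μ *ᴹ y') j) ⟩
          (linear-comb Q κ j +ᶠ linear-comb Q μ j) +ᶠ (((polar Q κ *ᴹ h) j +ᶠ (polar Q μ *ᴹ h) j) +ᶠ (polar Q μ *ᴹ y') j)
            ≡⟨ cong (λ e → (linear-comb Q κ j +ᶠ linear-comb Q μ j) +ᶠ (e +ᶠ (polar Q μ *ᴹ y') j)) (polar-+ Q κ μ h j) ⟩
          (linear-comb Q κ j +ᶠ linear-comb Q μ j) +ᶠ (polar Q (κ +ᵛ μ) *ᴹ h +ᵛ polar Q μ *ᴹ y') j ∎
          where open ≡-Reasoning

        combine-rhs : ∀ κ μ j → combine (A'ₗ ++ A'ᵣ) (κ ++ μ) j ≡ (linear-comb Q κ j +ᶠ linear-comb Q μ j) +ᶠ (polar Q μ *ᴹ y) j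
        combine-rhs κ μ j = trans (combine-++ A'ₗ A'ᵣ κ μ j)
          (trans (cong (linear-comb Q κ j +ᶠ_) (comb-linear-part Q μ y j)) (sym (𝔽.+-assoc _ _ _)))

        annihilators≡ : annihilators ≡ degenerate-pairs y y' h
        annihilators≡ = trans
          (sumH-++ d d (λ l → 𝟙 p (combine (Aₗ ++ Aᵣ) l =ᵛ combine (A'ₗ ++ A'ᵣ) l))
                       (λ l≗l' → cong (𝟙 p) (=ᵛ-cong (combine-cong (Aₗ ++ Aᵣ) l≗l') (combine-cong (A'ₗ ++ A'ᵣ) l≗l'))))
          (sumH-cong d (λ κ → sumH-cong d (λ μ → cong (𝟙 p) (allB-cong n (λ j →
            =ᶠ-cancelˡ (linear-comb Q κ j +ᶠ linear-comb Q μ j) (combine-lhs κ μ j) (combine-rhs κ μ j))))))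

      collisions-bound : 2 ≤ p → ∀ y y' h → collisions-at y y' h * p ^ (d + d) ≤ degenerate-pairs y y' h * p ^ n
      collisions-bound 2≤p y y' h =
        subst₂ (λ a b → a * p ^ (d + d) ≤ b * p ^ n) solutions≡ annihilators≡ (solutions-bound 2≤p)
        where open CollisionSystem y y' h

    module RankBound (p-odd : p % 2 ≡ 1) {n d : ℕ} (Q : Fin d → QuadPoly p n) (R : ℕ) (rank : QRankAtLeast p Q R)
                     (A : Vec p n → Bool) where
      open Collisions Q

      𝟘 : ∀ {k} → Vec p k
      𝟘 _ = 0ᶠ

      #A : ℕ
      #A = card p A

      degenerate-shifts : Vec p n → Vec p n → Vec p d → Vec p d → ℕ
      degenerate-shifts y y' κ μ = sumH p n (λ h → 𝟙 p (degenerate y y' h κ μ))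

      degenerate-count : Vec p d → Vec p d → ℕ
      degenerate-count κ μ = sumH p n (λ y → sumH p n (λ y' → (𝟙 p (A y) * 𝟙 p (A y')) * degenerate-shifts y y' κ μ))

      sumH²-*ʳ : ∀ {k} (g : Vec p k → Vec p k → ℕ) c →
                 sumH p k (λ y → sumH p k (λ y' → g y y')) * c ≡ sumH p k (λ y → sumH p k (λ y' → g y y' * c))
      sumH²-*ʳ {k} g c = trans (sym (sumH-*ʳ k _ c)) (sumH-cong k (λ y → sym (sumH-*ʳ k (g y) c)))

      #A²-*ʳ : ∀ c → sumH p n (λ y → sumH p n (λ y' → (𝟙 p (A y) * 𝟙 p (A y')) * c)) ≡ #A * #A * c
      #A²-*ʳ c = trans (sym (sumH²-*ʳ (λ y y' → 𝟙 p (A y) * 𝟙 p (A y')) c))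
                       (cong (_* c) (sym (sumH-*-sumH n n (λ y → 𝟙 p (A y)) (λ y' → 𝟙 p (A y')))))

      degenerate-count-*ʳ : ∀ κ μ c → degenerate-count κ μ * c
        ≡ sumH p n (λ y → sumH p n (λ y' → (𝟙 p (A y) * 𝟙 p (A y')) * (degenerate-shifts y y' κ μ * c)))
      degenerate-count-*ʳ κ μ c = trans (sumH²-*ʳ (λ y y' → (𝟙 p (A y) * 𝟙 p (A y')) * degenerate-shifts y y' κ μ) c)
        (sumH-cong n (λ y → sumH-cong n (λ y' → ℕₚ.*-assoc (𝟙 p (A y) * 𝟙 p (A y')) (degenerate-shifts y y' κ μ) c)))

      degenerate-shifts≤ : ∀ y y' κ μ → degenerate-shifts y y' κ μ ≤ p ^ n
      degenerate-shifts≤ y y' κ μ = subst (degenerate-shifts y y' κ μ ≤_) (trans (sumH-const n 1) (ℕₚ.*-identityʳ (p ^ n)))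
                                          (sumH-mono n (λ h → 𝟙≤1 (degenerate y y' h κ μ)))

      trivial-bound : ∀ κ μ → degenerate-count κ μ * p ^ R ≤ #A * #A * p ^ n * p ^ R
      trivial-bound κ μ = ℕₚ.*-monoˡ-≤ (p ^ R) (subst (degenerate-count κ μ ≤_) (#A²-*ʳ (p ^ n))
        (sumH-mono n (λ y → sumH-mono n (λ y' → ℕₚ.*-monoʳ-≤ (𝟙 p (A y) * 𝟙 p (A y')) (degenerate-shifts≤ y y' κ μ)))))

      -- κ + μ ≠ 0: for fixed y, y' the degenerate shifts h lie in one fibre of the rank-R form of κ + μ
      generic-bound : ∀ κ μ → (∃ λ i → (κ +ᵛ μ) i ≢ 0ᶠ) → degenerate-count κ μ * p ^ R ≤ #A * #A * p ^ n
      generic-bound κ μ nonzero = begin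
        degenerate-count κ μ * p ^ R
          ≡⟨ degenerate-count-*ʳ κ μ (p ^ R) ⟩
        sumH p n (λ y → sumH p n (λ y' → (𝟙 p (A y) * 𝟙 p (A y')) * (degenerate-shifts y y' κ μ * p ^ R)))
          ≤⟨ sumH-mono n (λ y → sumH-mono n (λ y' → ℕₚ.*-monoʳ-≤ (𝟙 p (A y) * 𝟙 p (A y')) (shifts-bound y y'))) ⟩
        sumH p n (λ y → sumH p n (λ y' → (𝟙 p (A y) * 𝟙 p (A y')) * p ^ n))
          ≡⟨ #A²-*ʳ (p ^ n) ⟩
        #A * #A * p ^ n ∎
        where
        open ℕₚ.≤-Reasoning
        S = symmetric-part p-odd Q (κ +ᵛ μ)
        target : Vec p n → Vec p n → Vec p n
        target y y' j = half p *ᶠ ((polar Q μ *ᴹ y) j +ᶠ -ᶠ (polar Q μ *ᴹ y') j)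
        in-fibre : ∀ y y' h → degenerate y y' h κ μ ≡ true → (S *ᴹ h =ᵛ target y y') ≡ true
        in-fibre y y' h deg = =ᵛ-complete (λ j → solve-double p-odd
          (trans (cong (_+ᶠ (polar Q μ *ᴹ y') j) (sym (polar-*ᴹ p-odd Q (κ +ᵛ μ) h j))) (=ᵛ-sound deg j)))
        shifts-bound : ∀ y y' → degenerate-shifts y y' κ μ * p ^ R ≤ p ^ n
        shifts-bound y y' = ℕₚ.≤-trans (ℕₚ.*-monoˡ-≤ (p ^ R) (sumH-mono n (λ h → 𝟙-mono (in-fibre y y' h))))
          (fibre-bound S (proj₁ (rank (κ +ᵛ μ) nonzero)) (proj₂ (rank (κ +ᵛ μ) nonzero)) (target y y'))

      -- κ + μ = 0 ≠ μ: the condition no longer involves h, and y' lies in one fibre of the rank-R form of μ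
      antidiagonal-bound : ∀ κ μ → (∀ i → (κ +ᵛ μ) i ≡ 0ᶠ) → (∃ λ i → μ i ≢ 0ᶠ) →
                           degenerate-count κ μ * p ^ R ≤ #A * (p ^ n * p ^ n)
      antidiagonal-bound κ μ κ+μ≡0 nonzero = begin
        degenerate-count κ μ * p ^ R
          ≡⟨ sumH²-*ʳ (λ y y' → (𝟙 p (A y) * 𝟙 p (A y')) * degenerate-shifts y y' κ μ) (p ^ R) ⟩
        sumH p n (λ y → sumH p n (λ y' → ((𝟙 p (A y) * 𝟙 p (A y')) * degenerate-shifts y y' κ μ) * p ^ R))
          ≤⟨ sumH-mono n (λ y → sumH-mono n (λ y' → ℕₚ.*-monoˡ-≤ (p ^ R) (pointwise y y'))) ⟩
        sumH p n (λ y → sumH p n (λ y' → (𝟙 p (A y) * (p ^ n * 𝟙 p (S *ᴹ y' =ᵛ S *ᴹ y))) * p ^ R))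
          ≡⟨ sumH-cong n (λ y → regroup y) ⟩
        sumH p n (λ y → 𝟙 p (A y) * (p ^ n * (sumH p n (λ y' → 𝟙 p (S *ᴹ y' =ᵛ S *ᴹ y)) * p ^ R)))
          ≤⟨ sumH-mono n (λ y → ℕₚ.*-monoʳ-≤ (𝟙 p (A y)) (ℕₚ.*-monoʳ-≤ (p ^ n)
               (fibre-bound S (proj₁ (rank μ nonzero)) (proj₂ (rank μ nonzero)) (S *ᴹ y)))) ⟩
        sumH p n (λ y → 𝟙 p (A y) * (p ^ n * p ^ n))
          ≡⟨ sumH-*ʳ n (λ y → 𝟙 p (A y)) (p ^ n * p ^ n) ⟩
        #A * (p ^ n * p ^ n) ∎
        where
        open ℕₚ.≤-Reasoning
        S = symmetric-part p-odd Q μ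
        same-image : ∀ y y' h → degenerate y y' h κ μ ≡ true → (S *ᴹ y' =ᵛ S *ᴹ y) ≡ true
        same-image y y' h deg = =ᵛ-complete (λ j → double-injective p-odd
          (trans (sym (polar-*ᴹ p-odd Q μ y' j))
          (trans (sym (𝔽.+-identityˡ ((polar Q μ *ᴹ y') j)))
          (trans (cong (_+ᶠ (polar Q μ *ᴹ y') j) (sym (polar-zero Q (κ +ᵛ μ) κ+μ≡0 h j)))
          (trans (=ᵛ-sound deg j) (polar-*ᴹ p-odd Q μ y j))))))
        pointwise : ∀ y y' → (𝟙 p (A y) * 𝟙 p (A y')) * degenerate-shifts y y' κ μ ≤ 𝟙 p (A y) * (p ^ n * 𝟙 p (S *ᴹ y' =ᵛ S *ᴹ y))
        pointwise y y' = begin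
          (𝟙 p (A y) * 𝟙 p (A y')) * degenerate-shifts y y' κ μ
            ≡⟨ ℕₚ.*-assoc (𝟙 p (A y)) _ _ ⟩
          𝟙 p (A y) * (𝟙 p (A y') * degenerate-shifts y y' κ μ)
            ≤⟨ ℕₚ.*-monoʳ-≤ (𝟙 p (A y)) (𝟙*≤ (A y') _) ⟩
          𝟙 p (A y) * degenerate-shifts y y' κ μ
            ≤⟨ ℕₚ.*-monoʳ-≤ (𝟙 p (A y)) (sumH-mono n (λ h → 𝟙-mono (same-image y y' h))) ⟩
          𝟙 p (A y) * sumH p n (λ _ → 𝟙 p (S *ᴹ y' =ᵛ S *ᴹ y))
            ≡⟨ cong (𝟙 p (A y) *_) (sumH-const n _) ⟩
          𝟙 p (A y) * (p ^ n * 𝟙 p (S *ᴹ y' =ᵛ S *ᴹ y)) ∎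
        regroup : ∀ y → sumH p n (λ y' → (𝟙 p (A y) * (p ^ n * 𝟙 p (S *ᴹ y' =ᵛ S *ᴹ y))) * p ^ R)
                      ≡ 𝟙 p (A y) * (p ^ n * (sumH p n (λ y' → 𝟙 p (S *ᴹ y' =ᵛ S *ᴹ y)) * p ^ R))
        regroup y = begin-equality
          sumH p n (λ y' → (𝟙 p (A y) * (p ^ n * 𝟙 p (S *ᴹ y' =ᵛ S *ᴹ y))) * p ^ R)
            ≡⟨ sumH-cong n (λ y' → trans (ℕₚ.*-assoc (𝟙 p (A y)) _ (p ^ R)) (cong (𝟙 p (A y) *_) (ℕₚ.*-assoc (p ^ n) _ (p ^ R)))) ⟩
          sumH p n (λ y' → 𝟙 p (A y) * (p ^ n * (𝟙 p (S *ᴹ y' =ᵛ S *ᴹ y) * p ^ R)))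
            ≡⟨ trans (sumH-*ˡ n (𝟙 p (A y)) _) (cong (𝟙 p (A y) *_) (sumH-*ˡ n (p ^ n) _)) ⟩
          𝟙 p (A y) * (p ^ n * sumH p n (λ y' → 𝟙 p (S *ᴹ y' =ᵛ S *ᴹ y) * p ^ R))
            ≡⟨ cong (λ e → 𝟙 p (A y) * (p ^ n * e)) (sumH-*ʳ n (λ y' → 𝟙 p (S *ᴹ y' =ᵛ S *ᴹ y)) (p ^ R)) ⟩
          𝟙 p (A y) * (p ^ n * (sumH p n (λ y' → 𝟙 p (S *ᴹ y' =ᵛ S *ᴹ y)) * p ^ R)) ∎

      trivial-term generic-term antidiagonal-term : ℕ
      trivial-term = #A * #A * p ^ n * p ^ R
      generic-term = #A * #A * p ^ n
      antidiagonal-term = #A * (p ^ n * p ^ n)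

      𝟘=⇒≡0 : ∀ {k} (v : Vec p k) → (𝟘 =ᵛ v) ≡ true → ∀ i → v i ≡ 0ᶠ
      𝟘=⇒≡0 v 𝟘=v i = sym (=ᵛ-sound {u = 𝟘} {v} 𝟘=v i)

      𝟘≠⇒≢0 : ∀ {k} (v : Vec p k) → (𝟘 =ᵛ v) ≡ false → ∃ λ i → v i ≢ 0ᶠ
      𝟘≠⇒≢0 v 𝟘≠v = proj₁ (=ᵛ-false {u = 𝟘} {v} 𝟘≠v) , (proj₂ (=ᵛ-false {u = 𝟘} {v} 𝟘≠v) ∘ sym)

      degenerate-count-bound : ∀ κ μ → degenerate-count κ μ * p ^ R ≤
        𝟙 p (𝟘 =ᵛ κ) * (𝟙 p (𝟘 =ᵛ μ) * trivial-term) + generic-term + 𝟙 p (𝟘 =ᵛ κ +ᵛ μ) * antidiagonal-term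
      degenerate-count-bound κ μ with 𝟘 =ᵛ κ +ᵛ μ in κ+μ≟0 | 𝟘 =ᵛ μ in μ≟0 | 𝟘 =ᵛ κ in κ≟0
      ... | false | b | b' = ℕₚ.≤-trans (generic-bound κ μ (𝟘≠⇒≢0 (κ +ᵛ μ) κ+μ≟0))
                                        (n≤m+n+o (𝟙 p b' * (𝟙 p b * trivial-term)) generic-term (0 * antidiagonal-term))
      ... | true  | false | b' = ℕₚ.≤-trans (antidiagonal-bound κ μ (𝟘=⇒≡0 (κ +ᵛ μ) κ+μ≟0) (𝟘≠⇒≢0 μ μ≟0))
        (subst (_≤ 𝟙 p b' * (0 * trivial-term) + generic-term + 1 * antidiagonal-term) (ℕₚ.*-identityˡ antidiagonal-term)
               (o≤m+n+o (𝟙 p b' * (0 * trivial-term)) generic-term (1 * antidiagonal-term)))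
      ... | true  | true  | true  = ℕₚ.≤-trans (trivial-bound κ μ)
        (subst (_≤ 1 * (1 * trivial-term) + generic-term + 1 * antidiagonal-term) (trans (ℕₚ.*-identityˡ _) (ℕₚ.*-identityˡ trivial-term))
               (m≤m+n+o (1 * (1 * trivial-term)) generic-term (1 * antidiagonal-term)))
      ... | true  | true  | false = ⊥-elim (κᵢ≢0 (begin
        κ i             ≡⟨ 𝔽.+-identityʳ (κ i) ⟨
        κ i +ᶠ 0ᶠ       ≡⟨ cong (κ i +ᶠ_) (𝟘=⇒≡0 μ μ≟0 i) ⟨
        κ i +ᶠ μ i      ≡⟨ 𝟘=⇒≡0 (κ +ᵛ μ) κ+μ≟0 i ⟩
        0ᶠ              ∎))
        where
        open ≡-Reasoning
        i = proj₁ (𝟘≠⇒≢0 κ κ≟0)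
        κᵢ≢0 = proj₂ (𝟘≠⇒≢0 κ κ≟0)

      antipode-unique : ∀ κ → sumH p d (λ μ → 𝟙 p (𝟘 =ᵛ κ +ᵛ μ)) ≡ 1
      antipode-unique κ = trans
        (sumH-cong d (λ μ → cong (𝟙 p) (allB-cong d (λ i → =ᶠ-cong-⇔
          (λ 0≡κ+μ → sym (𝔽Group.inverseʳ-unique (κ i) (μ i) (sym 0≡κ+μ)))
          (λ -κ≡μ → trans (sym (𝔽.-‿inverseʳ (κ i))) (cong (κ i +ᶠ_) -κ≡μ))))))
        (sumH-δ-1 d (λ i → -ᶠ κ i))

      total-degenerate-bound :
        sumH p d (λ κ → sumH p d (λ μ → degenerate-count κ μ)) * p ^ R ≤ trivial-term + p ^ d * (p ^ d * generic-term) + p ^ d * (1 * antidiagonal-term)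
      total-degenerate-bound = begin
        sumH p d (λ κ → sumH p d (λ μ → degenerate-count κ μ)) * p ^ R
          ≡⟨ sumH²-*ʳ degenerate-count (p ^ R) ⟩
        sumH p d (λ κ → sumH p d (λ μ → degenerate-count κ μ * p ^ R))
          ≤⟨ sumH-mono d (λ κ → sumH-mono d (λ μ → degenerate-count-bound κ μ)) ⟩
        sumH p d (λ κ → sumH p d (λ μ → 𝟙 p (𝟘 =ᵛ κ) * (𝟙 p (𝟘 =ᵛ μ) * trivial-term) + generic-term + 𝟙 p (𝟘 =ᵛ κ +ᵛ μ) * antidiagonal-term))
          ≡⟨ sumH-cong d inner ⟩
        sumH p d (λ κ → 𝟙 p (𝟘 =ᵛ κ) * trivial-term + p ^ d * generic-term + 1 * antidiagonal-term)
          ≡⟨ trans (sumH-+ d _ _) (cong₂ _+_ (trans (sumH-+ d _ _)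
               (cong₂ _+_ (sumH-δ d 𝟘 (λ _ → trivial-term) (λ _ → refl)) (sumH-const d _))) (sumH-const d _)) ⟩
        trivial-term + p ^ d * (p ^ d * generic-term) + p ^ d * (1 * antidiagonal-term) ∎
        where
        open ℕₚ.≤-Reasoning
        inner : ∀ κ → sumH p d (λ μ → 𝟙 p (𝟘 =ᵛ κ) * (𝟙 p (𝟘 =ᵛ μ) * trivial-term) + generic-term + 𝟙 p (𝟘 =ᵛ κ +ᵛ μ) * antidiagonal-term)
                      ≡ 𝟙 p (𝟘 =ᵛ κ) * trivial-term + p ^ d * generic-term + 1 * antidiagonal-term
        inner κ = trans (sumH-+ d _ _) (cong₂ _+_
          (trans (sumH-+ d _ _) (cong₂ _+_
            (trans (sumH-*ˡ d (𝟙 p (𝟘 =ᵛ κ)) _) (cong (𝟙 p (𝟘 =ᵛ κ) *_) (sumH-δ d 𝟘 (λ _ → trivial-term) (λ _ → refl))))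
            (sumH-const d generic-term)))
          (trans (sumH-*ʳ d _ antidiagonal-term) (cong (_* antidiagonal-term) (antipode-unique κ))))

    -- The second moment

    module SecondMoment (p-odd : p % 2 ≡ 1) {n d : ℕ} (Q : Fin d → QuadPoly p n) (R : ℕ) (rank : QRankAtLeast p Q R)
                        (A : Vec p n → Bool) (A⊆Z₀ : ∀ y → A y ≡ true → inZ0 p Q y ≡ true) where
      open Collisions Q
      open RankBound p-odd Q R rank A

      S : Vec p d → Vec p d → ℕ
      S c₁ c₂ = sumH p n (λ x → sumH p n (λ y → 𝟙 p (A y) * (𝟙 p (values x =ᵛ c₁) * 𝟙 p (values (x +ᵛ y) =ᵛ c₂))))

      progression-closed : ∀ x y → inZ p Q x ≡ true → inZ p Q (x +ᵛ y) ≡ true → inZ0 p Q y ≡ true →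
                           inZ p Q ((x +ᵛ y) +ᵛ y) ≡ true
      progression-closed x y Zx Zx+y Z₀y = =ᵛ-complete (λ i → 𝔽Quasigroup.cancelʳ (values x i) _ _ (begin
        values ((x +ᵛ y) +ᵛ y) i +ᶠ values x i
          ≡⟨ evalQ-second-difference (Q i) x y ⟩
        (values (x +ᵛ y) i +ᶠ values (x +ᵛ y) i) +ᶠ (B[_,_] (Q i) y y +ᶠ B[_,_] (Q i) y y)
          ≡⟨ cong₂ (λ a b → (a +ᶠ a) +ᶠ (b +ᶠ b)) (=ᵛ-sound {u = values (x +ᵛ y)} {v = 𝟘} Zx+y i)
                                                  (=ᵛ-sound {u = λ i → evalQ0 p (Q i) y} {v = 𝟘} Z₀y i) ⟩
        (0ᶠ +ᶠ 0ᶠ) +ᶠ (0ᶠ +ᶠ 0ᶠ)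
          ≡⟨ cong₂ _+ᶠ_ (𝔽.+-identityˡ 0ᶠ) (𝔽.+-identityˡ 0ᶠ) ⟩
        0ᶠ +ᶠ 0ᶠ
          ≡⟨ cong (0ᶠ +ᶠ_) (=ᵛ-sound {u = values x} {v = 𝟘} Zx i) ⟨
        0ᶠ +ᶠ values x i ∎))
        where open ≡-Reasoning

      count≡S𝟘𝟘 : count p Q A ≡ S 𝟘 𝟘
      count≡S𝟘𝟘 = sumH-cong n (λ x → sumH-cong n (λ y →
        𝟙-redundant (inZ p Q x) (inZ p Q (x +ᵛ y)) (inZ p Q ((x +ᵛ y) +ᵛ y)) (A y)
                    (λ Zx Zx+y y∈A → progression-closed x y Zx Zx+y (A⊆Z₀ y y∈A))))

      δ²-collapse : ∀ a (u₁ u₂ : Vec p d) →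
                    sumH p d (λ c₁ → sumH p d (λ c₂ → a * (𝟙 p (u₁ =ᵛ c₁) * 𝟙 p (u₂ =ᵛ c₂)))) ≡ a
      δ²-collapse a u₁ u₂ = begin
        sumH p d (λ c₁ → sumH p d (λ c₂ → a * (𝟙 p (u₁ =ᵛ c₁) * 𝟙 p (u₂ =ᵛ c₂))))
          ≡⟨ sumH-cong d (λ c₁ → trans (sumH-*ˡ d a _) (cong (a *_) (trans (sumH-*ˡ d (𝟙 p (u₁ =ᵛ c₁)) _)
                                                                          (cong (𝟙 p (u₁ =ᵛ c₁) *_) (sumH-δ-1 d u₂))))) ⟩
        sumH p d (λ c₁ → a * (𝟙 p (u₁ =ᵛ c₁) * 1))
          ≡⟨ trans (sumH-*ˡ d a _) (cong (a *_) (trans (sumH-cong d (λ c₁ → ℕₚ.*-identityʳ _)) (sumH-δ-1 d u₁))) ⟩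
        a * 1
          ≡⟨ ℕₚ.*-identityʳ a ⟩
        a ∎
        where open ≡-Reasoning

      ΣS≡ : sumH p d (λ c₁ → sumH p d (λ c₂ → S c₁ c₂)) ≡ p ^ n * #A
      ΣS≡ = begin
        sumH p d (λ c₁ → sumH p d (λ c₂ → sumH p n (λ x → sumH p n (λ y → term x y c₁ c₂))))
          ≡⟨ sumH-pull₂ n d (λ x c₁ c₂ → sumH p n (λ y → term x y c₁ c₂)) ⟨
        sumH p n (λ x → sumH p d (λ c₁ → sumH p d (λ c₂ → sumH p n (λ y → term x y c₁ c₂))))
          ≡⟨ sumH-cong n (λ x → sumH-pull₂ n d (λ y c₁ c₂ → term x y c₁ c₂)) ⟨
        sumH p n (λ x → sumH p n (λ y → sumH p d (λ c₁ → sumH p d (λ c₂ → term x y c₁ c₂))))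
          ≡⟨ sumH-cong n (λ x → sumH-cong n (λ y → δ²-collapse (𝟙 p (A y)) (values x) (values (x +ᵛ y)))) ⟩
        sumH p n (λ x → #A)
          ≡⟨ sumH-const n #A ⟩
        p ^ n * #A ∎
        where
        open ≡-Reasoning
        term : Vec p n → Vec p n → Vec p d → Vec p d → ℕ
        term x y c₁ c₂ = 𝟙 p (A y) * (𝟙 p (values x =ᵛ c₁) * 𝟙 p (values (x +ᵛ y) =ᵛ c₂))

      pair-collisions : ℕ
      pair-collisions = sumH p n (λ x → sumH p n (λ x' → sumH p n (λ y → sumH p n (λ y' →
        (𝟙 p (A y) * 𝟙 p (A y')) * (𝟙 p (values x' =ᵛ values x) * 𝟙 p (values (x' +ᵛ y') =ᵛ values (x +ᵛ y)))))))

      ΣS²≡ : sumH p d (λ c₁ → sumH p d (λ c₂ → S c₁ c₂ * S c₁ c₂)) ≡ pair-collisions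
      ΣS²≡ = begin
        sumH p d (λ c₁ → sumH p d (λ c₂ → S c₁ c₂ * S c₁ c₂))
          ≡⟨ sumH-cong d (λ c₁ → sumH-cong d (λ c₂ → square c₁ c₂)) ⟩
        sumH p d (λ c₁ → sumH p d (λ c₂ → sumH p n (λ x → sumH p n (λ x' → sumH p n (λ y → sumH p n (λ y' → pair x x' y y' c₁ c₂))))))
          ≡⟨ sumH-pull₂ n d (λ x c₁ c₂ → sumH p n (λ x' → sumH p n (λ y → sumH p n (λ y' → pair x x' y y' c₁ c₂)))) ⟨
        sumH p n (λ x → sumH p d (λ c₁ → sumH p d (λ c₂ → sumH p n (λ x' → sumH p n (λ y → sumH p n (λ y' → pair x x' y y' c₁ c₂))))))
          ≡⟨ sumH-cong n (λ x → trans (sym (sumH-pull₂ n d (λ x' c₁ c₂ → sumH p n (λ y → sumH p n (λ y' → pair x x' y y' c₁ c₂)))))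
               (sumH-cong n (λ x' → trans (sym (sumH-pull₂ n d (λ y c₁ c₂ → sumH p n (λ y' → pair x x' y y' c₁ c₂))))
                 (sumH-cong n (λ y → trans (sym (sumH-pull₂ n d (λ y' c₁ c₂ → pair x x' y y' c₁ c₂)))
                   (sumH-cong n (λ y' → collapse x x' y y'))))))) ⟩
        pair-collisions ∎
        where
        open ≡-Reasoning
        term : Vec p n → Vec p n → Vec p d → Vec p d → ℕ
        term x y c₁ c₂ = 𝟙 p (A y) * (𝟙 p (values x =ᵛ c₁) * 𝟙 p (values (x +ᵛ y) =ᵛ c₂))
        pair : Vec p n → Vec p n → Vec p n → Vec p n → Vec p d → Vec p d → ℕ
        pair x x' y y' c₁ c₂ = term x y c₁ c₂ * term x' y' c₁ c₂
        square : ∀ c₁ c₂ → S c₁ c₂ * S c₁ c₂ ≡ sumH p n (λ x → sumH p n (λ x' → sumH p n (λ y → sumH p n (λ y' → pair x x' y y' c₁ c₂))))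
        square c₁ c₂ = trans (sumH-*-sumH n n _ _) (sumH-cong n (λ x → sumH-cong n (λ x' → sumH-*-sumH n n _ _)))
        δ-match : ∀ (u u' : Vec p d) → sumH p d (λ c → 𝟙 p (u =ᵛ c) * 𝟙 p (u' =ᵛ c)) ≡ 𝟙 p (u' =ᵛ u)
        δ-match u u' = sumH-δ d u (λ c → 𝟙 p (u' =ᵛ c)) (λ c≗c' → cong (𝟙 p) (=ᵛ-cong (λ _ → refl) c≗c'))
        interleave : ∀ a b₁ b₂ a' b₁' b₂' → (a * (b₁ * b₂)) * (a' * (b₁' * b₂')) ≡ (a * a') * ((b₁ * b₁') * (b₂ * b₂'))
        interleave = ℕ-solve-∀
        collapse : ∀ x x' y y' → sumH p d (λ c₁ → sumH p d (λ c₂ → pair x x' y y' c₁ c₂))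
          ≡ (𝟙 p (A y) * 𝟙 p (A y')) * (𝟙 p (values x' =ᵛ values x) * 𝟙 p (values (x' +ᵛ y') =ᵛ values (x +ᵛ y)))
        collapse x x' y y' = begin
          sumH p d (λ c₁ → sumH p d (λ c₂ → pair x x' y y' c₁ c₂))
            ≡⟨ sumH-cong d (λ c₁ → sumH-cong d (λ c₂ → interleave (𝟙 p (A y)) (𝟙 p (values x =ᵛ c₁)) (𝟙 p (values (x +ᵛ y) =ᵛ c₂))
                                                                  (𝟙 p (A y')) (𝟙 p (values x' =ᵛ c₁)) (𝟙 p (values (x' +ᵛ y') =ᵛ c₂)))) ⟩
          sumH p d (λ c₁ → sumH p d (λ c₂ → (𝟙 p (A y) * 𝟙 p (A y')) * (δ₁ c₁ * δ₂ c₂)))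
            ≡⟨ sumH-cong d (λ c₁ → trans (sumH-*ˡ d (𝟙 p (A y) * 𝟙 p (A y')) (λ c₂ → δ₁ c₁ * δ₂ c₂))
                                         (cong ((𝟙 p (A y) * 𝟙 p (A y')) *_) (sumH-*ˡ d (δ₁ c₁) δ₂))) ⟩
          sumH p d (λ c₁ → (𝟙 p (A y) * 𝟙 p (A y')) * (δ₁ c₁ * sumH p d δ₂))
            ≡⟨ trans (sumH-*ˡ d (𝟙 p (A y) * 𝟙 p (A y')) (λ c₁ → δ₁ c₁ * sumH p d δ₂))
                     (cong ((𝟙 p (A y) * 𝟙 p (A y')) *_) (sumH-*ʳ d δ₁ (sumH p d δ₂))) ⟩
          (𝟙 p (A y) * 𝟙 p (A y')) * (sumH p d δ₁ * sumH p d δ₂)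
            ≡⟨ cong ((𝟙 p (A y) * 𝟙 p (A y')) *_) (cong₂ _*_ (δ-match (values x) (values x')) (δ-match (values (x +ᵛ y)) (values (x' +ᵛ y')))) ⟩
          (𝟙 p (A y) * 𝟙 p (A y')) * (𝟙 p (values x' =ᵛ values x) * 𝟙 p (values (x' +ᵛ y') =ᵛ values (x +ᵛ y))) ∎
          where
          δ₁ δ₂ : Vec p d → ℕ
          δ₁ c = 𝟙 p (values x =ᵛ c) * 𝟙 p (values x' =ᵛ c)
          δ₂ c = 𝟙 p (values (x +ᵛ y) =ᵛ c) * 𝟙 p (values (x' +ᵛ y') =ᵛ c)

      values-cong : ∀ {x x' : Vec p n} → x ≗ x' → values x ≗ values x'
      values-cong x≗x' i = evalQ-cong (Q i) x≗x'

      -- substitute x' = h + x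
      pair-collisions≡ : pair-collisions ≡ sumH p n (λ y → sumH p n (λ y' → sumH p n (λ h → (𝟙 p (A y) * 𝟙 p (A y')) * collisions-at y y' h)))
      pair-collisions≡ = begin
        sumH p n (λ x → sumH p n (G x))
          ≡⟨ sumH-cong n (λ x → sumH-translate n (G x) x (G-ext x)) ⟨
        sumH p n (λ x → sumH p n (λ h → G x (h +ᵛ x)))
          ≡⟨ sumH-comm n n (λ x h → G x (h +ᵛ x)) ⟩
        sumH p n (λ h → sumH p n (λ x → G x (h +ᵛ x)))
          ≡⟨ sumH-cong n (λ h → sumH-pull₂ n n (λ x y y' → summand y y' h x)) ⟩
        sumH p n (λ h → sumH p n (λ y → sumH p n (λ y' → sumH p n (λ x → summand y y' h x))))
          ≡⟨ sumH-pull₂ n n (λ h y y' → sumH p n (λ x → summand y y' h x)) ⟩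
        sumH p n (λ y → sumH p n (λ y' → sumH p n (λ h → sumH p n (λ x → summand y y' h x))))
          ≡⟨ sumH-cong n (λ y → sumH-cong n (λ y' → sumH-cong n (λ h → sumH-*ˡ n (𝟙 p (A y) * 𝟙 p (A y')) _))) ⟩
        sumH p n (λ y → sumH p n (λ y' → sumH p n (λ h → (𝟙 p (A y) * 𝟙 p (A y')) * collisions-at y y' h))) ∎
        where
        open ≡-Reasoning
        G : Vec p n → Vec p n → ℕ
        G x x' = sumH p n (λ y → sumH p n (λ y' →
          (𝟙 p (A y) * 𝟙 p (A y')) * (𝟙 p (values x' =ᵛ values x) * 𝟙 p (values (x' +ᵛ y') =ᵛ values (x +ᵛ y)))))
        G-ext : ∀ x → G x Preserves _≗_ ⟶ _≡_
        G-ext x x'≗x'' = sumH-cong n (λ y → sumH-cong n (λ y' → cong ((𝟙 p (A y) * 𝟙 p (A y')) *_) (cong₂ _*_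
          (cong (𝟙 p) (=ᵛ-cong (values-cong x'≗x'') (λ _ → refl)))
          (cong (𝟙 p) (=ᵛ-cong (values-cong (λ i → cong (_+ᶠ y' i) (x'≗x'' i))) (λ _ → refl))))))
        summand : Vec p n → Vec p n → Vec p n → Vec p n → ℕ
        summand y y' h x = (𝟙 p (A y) * 𝟙 p (A y')) *
          (𝟙 p (values (h +ᵛ x) =ᵛ values x) * 𝟙 p (values ((h +ᵛ x) +ᵛ y') =ᵛ values (x +ᵛ y)))

      degenerate-total≡ : sumH p n (λ y → sumH p n (λ y' → sumH p n (λ h → (𝟙 p (A y) * 𝟙 p (A y')) * degenerate-pairs y y' h)))
                          ≡ sumH p d (λ κ → sumH p d (λ μ → degenerate-count κ μ))
      degenerate-total≡ = begin
        sumH p n (λ y → sumH p n (λ y' → sumH p n (λ h → (𝟙 p (A y) * 𝟙 p (A y')) * degenerate-pairs y y' h)))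
          ≡⟨ sumH-cong n (λ y → sumH-cong n (λ y' → trans (sumH-cong n (λ h → distribute y y' h))
                                                          (sumH-pull₂ n d (λ h κ μ → term y y' h κ μ)))) ⟩
        sumH p n (λ y → sumH p n (λ y' → sumH p d (λ κ → sumH p d (λ μ → sumH p n (λ h → term y y' h κ μ)))))
          ≡⟨ sumH-cong n (λ y → sumH-pull₂ n d (λ y' κ μ → sumH p n (λ h → term y y' h κ μ))) ⟩
        sumH p n (λ y → sumH p d (λ κ → sumH p d (λ μ → sumH p n (λ y' → sumH p n (λ h → term y y' h κ μ)))))
          ≡⟨ sumH-pull₂ n d (λ y κ μ → sumH p n (λ y' → sumH p n (λ h → term y y' h κ μ))) ⟩
        sumH p d (λ κ → sumH p d (λ μ → sumH p n (λ y → sumH p n (λ y' → sumH p n (λ h → term y y' h κ μ)))))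
          ≡⟨ sumH-cong d (λ κ → sumH-cong d (λ μ → sumH-cong n (λ y → sumH-cong n (λ y' → sumH-*ˡ n (𝟙 p (A y) * 𝟙 p (A y')) _)))) ⟩
        sumH p d (λ κ → sumH p d (λ μ → degenerate-count κ μ)) ∎
        where
        open ≡-Reasoning
        term : Vec p n → Vec p n → Vec p n → Vec p d → Vec p d → ℕ
        term y y' h κ μ = (𝟙 p (A y) * 𝟙 p (A y')) * 𝟙 p (degenerate y y' h κ μ)
        distribute : ∀ y y' h → (𝟙 p (A y) * 𝟙 p (A y')) * degenerate-pairs y y' h ≡ sumH p d (λ κ → sumH p d (λ μ → term y y' h κ μ))
        distribute y y' h = trans (sym (sumH-*ˡ d (𝟙 p (A y) * 𝟙 p (A y')) (λ κ → sumH p d (λ μ → 𝟙 p (degenerate y y' h κ μ)))))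
                                  (sumH-cong d (λ κ → sym (sumH-*ˡ d (𝟙 p (A y) * 𝟙 p (A y')) (λ μ → 𝟙 p (degenerate y y' h κ μ)))))

      pair-collisions-bound : 2 ≤ p → pair-collisions * p ^ (d + d) ≤ sumH p d (λ κ → sumH p d (λ μ → degenerate-count κ μ)) * p ^ n
      pair-collisions-bound 2≤p = begin
        pair-collisions * p ^ (d + d)
          ≡⟨ cong (_* p ^ (d + d)) pair-collisions≡ ⟩
        sumH p n (λ y → sumH p n (λ y' → sumH p n (λ h → (𝟙 p (A y) * 𝟙 p (A y')) * collisions-at y y' h))) * p ^ (d + d)
          ≡⟨ sumH³-*ʳ (λ y y' h → (𝟙 p (A y) * 𝟙 p (A y')) * collisions-at y y' h) (p ^ (d + d)) ⟩
        sumH p n (λ y → sumH p n (λ y' → sumH p n (λ h → (𝟙 p (A y) * 𝟙 p (A y')) * collisions-at y y' h * p ^ (d + d))))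
          ≤⟨ sumH-mono n (λ y → sumH-mono n (λ y' → sumH-mono n (λ h → subst₂ _≤_
               (sym (ℕₚ.*-assoc (𝟙 p (A y) * 𝟙 p (A y')) (collisions-at y y' h) (p ^ (d + d))))
               (sym (ℕₚ.*-assoc (𝟙 p (A y) * 𝟙 p (A y')) (degenerate-pairs y y' h) (p ^ n)))
               (ℕₚ.*-monoʳ-≤ (𝟙 p (A y) * 𝟙 p (A y')) (collisions-bound 2≤p y y' h))))) ⟩
        sumH p n (λ y → sumH p n (λ y' → sumH p n (λ h → (𝟙 p (A y) * 𝟙 p (A y')) * degenerate-pairs y y' h * p ^ n)))
          ≡⟨ sumH³-*ʳ (λ y y' h → (𝟙 p (A y) * 𝟙 p (A y')) * degenerate-pairs y y' h) (p ^ n) ⟨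
        sumH p n (λ y → sumH p n (λ y' → sumH p n (λ h → (𝟙 p (A y) * 𝟙 p (A y')) * degenerate-pairs y y' h))) * p ^ n
          ≡⟨ cong (_* p ^ n) degenerate-total≡ ⟩
        sumH p d (λ κ → sumH p d (λ μ → degenerate-count κ μ)) * p ^ n ∎
        where
        open ℕₚ.≤-Reasoning
        sumH³-*ʳ : ∀ (f : Vec p n → Vec p n → Vec p n → ℕ) c →
          sumH p n (λ a → sumH p n (λ b → sumH p n (λ e → f a b e))) * c ≡ sumH p n (λ a → sumH p n (λ b → sumH p n (λ e → f a b e * c)))
        sumH³-*ʳ f c = trans (sym (sumH-*ʳ n _ c)) (sumH-cong n (λ a → trans (sym (sumH-*ʳ n _ c)) (sumH-cong n (λ b → sym (sumH-*ʳ n _ c)))))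

      m E a : ℕ
      m = p ^ (d + d)
      E = p ^ n
      a = E * #A

      Σ² : (Vec p d → Vec p d → ℕ) → ℕ
      Σ² f = sumH p d (λ c₁ → sumH p d (λ c₂ → f c₁ c₂))

      Σ²-+ : ∀ f g → Σ² (λ c₁ c₂ → f c₁ c₂ + g c₁ c₂) ≡ Σ² f + Σ² g
      Σ²-+ f g = trans (sumH-cong d (λ c₁ → sumH-+ d (f c₁) (g c₁))) (sumH-+ d _ _)

      Σ²-*ˡ : ∀ k f → Σ² (λ c₁ c₂ → k * f c₁ c₂) ≡ k * Σ² f
      Σ²-*ˡ k f = trans (sumH-cong d (λ c₁ → sumH-*ˡ d k (f c₁))) (sumH-*ˡ d k _)

      m≡p^d*p^d : m ≡ p ^ d * p ^ d
      m≡p^d*p^d = ℕₚ.^-distribˡ-+-* p d d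

      deviation : Vec p d → Vec p d → ℕ
      deviation c₁ c₂ = ℕ.∣ S c₁ c₂ * m - a ∣

      variance : ℕ
      variance = Σ² (λ c₁ c₂ → deviation c₁ c₂ * deviation c₁ c₂)

      variance-identity : variance + m * (a * a) ≡ Σ² (λ c₁ c₂ → S c₁ c₂ * S c₁ c₂) * (m * m)
      variance-identity = ℕₚ.+-cancelʳ-≡ (m * (a * a)) _ _ (begin
        variance + m * (a * a) + m * (a * a)
          ≡⟨ trans (ℕₚ.+-assoc variance _ _) (cong (variance +_) (sym cross-terms)) ⟩
        variance + Σ² (λ c₁ c₂ → 2 * (a * (S c₁ c₂ * m)))
          ≡⟨ Σ²-+ (λ c₁ c₂ → deviation c₁ c₂ * deviation c₁ c₂) (λ c₁ c₂ → 2 * (a * (S c₁ c₂ * m))) ⟨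
        Σ² (λ c₁ c₂ → deviation c₁ c₂ * deviation c₁ c₂ + 2 * (a * (S c₁ c₂ * m)))
          ≡⟨ sumH-cong d (λ c₁ → sumH-cong d (λ c₂ → ∣m-n∣²+2nm≡m²+n² (S c₁ c₂ * m) a)) ⟩
        Σ² (λ c₁ c₂ → (S c₁ c₂ * m) * (S c₁ c₂ * m) + a * a)
          ≡⟨ Σ²-+ (λ c₁ c₂ → (S c₁ c₂ * m) * (S c₁ c₂ * m)) (λ _ _ → a * a) ⟩
        Σ² (λ c₁ c₂ → (S c₁ c₂ * m) * (S c₁ c₂ * m)) + Σ² (λ _ _ → a * a)
          ≡⟨ cong₂ _+_ squares constants ⟩
        Σ² (λ c₁ c₂ → S c₁ c₂ * S c₁ c₂) * (m * m) + m * (a * a) ∎)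
        where
        open ≡-Reasoning
        cross-terms : Σ² (λ c₁ c₂ → 2 * (a * (S c₁ c₂ * m))) ≡ m * (a * a) + m * (a * a)
        cross-terms = begin
          Σ² (λ c₁ c₂ → 2 * (a * (S c₁ c₂ * m)))
            ≡⟨ trans (Σ²-*ˡ 2 (λ c₁ c₂ → a * (S c₁ c₂ * m))) (cong (2 *_) (Σ²-*ˡ a (λ c₁ c₂ → S c₁ c₂ * m))) ⟩
          2 * (a * Σ² (λ c₁ c₂ → S c₁ c₂ * m))
            ≡⟨ cong (λ e → 2 * (a * e)) (trans (sym (sumH²-*ʳ S m)) (cong (_* m) ΣS≡)) ⟩
          2 * (a * (a * m))
            ≡⟨ double a m ⟩
          m * (a * a) + m * (a * a) ∎
          where
          double : ∀ a m → 2 * (a * (a * m)) ≡ m * (a * a) + m * (a * a)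
          double = ℕ-solve-∀
        squares : Σ² (λ c₁ c₂ → (S c₁ c₂ * m) * (S c₁ c₂ * m)) ≡ Σ² (λ c₁ c₂ → S c₁ c₂ * S c₁ c₂) * (m * m)
        squares = trans (sumH-cong d (λ c₁ → sumH-cong d (λ c₂ → interchange (S c₁ c₂) m)))
                        (sym (sumH²-*ʳ (λ c₁ c₂ → S c₁ c₂ * S c₁ c₂) (m * m)))
          where
          interchange : ∀ s m → (s * m) * (s * m) ≡ (s * s) * (m * m)
          interchange = ℕ-solve-∀
        constants : Σ² (λ _ _ → a * a) ≡ m * (a * a)
        constants = trans (sumH-cong d (λ c₁ → sumH-const d (a * a)))
                          (trans (sumH-const d _) (trans (sym (ℕₚ.*-assoc (p ^ d) (p ^ d) (a * a))) (cong (_* (a * a)) (sym m≡p^d*p^d))))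

      variance-bound : 2 ≤ p → variance * p ^ R ≤ m * E * (p ^ d * (p ^ d * generic-term)) + m * E * (p ^ d * (1 * antidiagonal-term))
      variance-bound 2≤p = ℕₚ.+-cancelˡ-≤ (m * (a * a) * p ^ R) _ _ (begin
        m * (a * a) * p ^ R + variance * p ^ R
          ≡⟨ trans (ℕₚ.+-comm _ (variance * p ^ R)) (sym (ℕₚ.*-distribʳ-+ (p ^ R) variance (m * (a * a)))) ⟩
        (variance + m * (a * a)) * p ^ R
          ≡⟨ cong (_* p ^ R) (trans variance-identity (cong (_* (m * m)) ΣS²≡)) ⟩
        pair-collisions * (m * m) * p ^ R
          ≡⟨ regroup₁ pair-collisions m (p ^ R) ⟩
        m * ((pair-collisions * m) * p ^ R)
          ≤⟨ ℕₚ.*-monoʳ-≤ m (ℕₚ.*-monoˡ-≤ (p ^ R) (pair-collisions-bound 2≤p)) ⟩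
        m * ((W * E) * p ^ R)
          ≡⟨ regroup₂ m W E (p ^ R) ⟩
        m * E * (W * p ^ R)
          ≤⟨ ℕₚ.*-monoʳ-≤ (m * E) total-degenerate-bound ⟩
        m * E * (trivial-term + p ^ d * (p ^ d * generic-term) + p ^ d * (1 * antidiagonal-term))
          ≡⟨ distribute m E trivial-term (p ^ d * (p ^ d * generic-term)) (p ^ d * (1 * antidiagonal-term)) ⟩
        m * E * trivial-term + (m * E * (p ^ d * (p ^ d * generic-term)) + m * E * (p ^ d * (1 * antidiagonal-term)))
          ≡⟨ cong (_+ (m * E * (p ^ d * (p ^ d * generic-term)) + m * E * (p ^ d * (1 * antidiagonal-term)))) (regroup₃ m E #A (p ^ R)) ⟩
        m * (a * a) * p ^ R + (m * E * (p ^ d * (p ^ d * generic-term)) + m * E * (p ^ d * (1 * antidiagonal-term))) ∎)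
        where
        open ℕₚ.≤-Reasoning
        W = sumH p d (λ κ → sumH p d (λ μ → degenerate-count κ μ))
        regroup₁ : ∀ c m r → c * (m * m) * r ≡ m * ((c * m) * r)
        regroup₁ = ℕ-solve-∀
        regroup₂ : ∀ m w e r → m * ((w * e) * r) ≡ m * e * (w * r)
        regroup₂ = ℕ-solve-∀
        distribute : ∀ m e x y z → m * e * (x + y + z) ≡ m * e * x + (m * e * y + m * e * z)
        distribute = ℕ-solve-∀
        regroup₃ : ∀ m e c r → m * e * (c * c * e * r) ≡ m * ((e * c) * (e * c)) * r
        regroup₃ = ℕ-solve-∀

      #A≤E : #A ≤ E
      #A≤E = subst (#A ≤_) (trans (sumH-const n 1) (ℕₚ.*-identityʳ E)) (sumH-mono n (λ y → 𝟙≤1 (A y)))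

      error-bound : m * E * (p ^ d * (p ^ d * generic-term)) + m * E * (p ^ d * (1 * antidiagonal-term)) ≤ 2 * (m * m * (E * E * E * E))
      error-bound = begin
        m * E * (p ^ d * (p ^ d * generic-term)) + m * E * (p ^ d * (1 * antidiagonal-term))
          ≡⟨ cong (λ e → m * E * e + m * E * (p ^ d * (1 * antidiagonal-term)))
                  (trans (sym (ℕₚ.*-assoc (p ^ d) (p ^ d) generic-term)) (cong (_* generic-term) (sym m≡p^d*p^d))) ⟩
        m * E * (m * generic-term) + m * E * (p ^ d * (1 * antidiagonal-term))
          ≤⟨ ℕₚ.+-monoʳ-≤ (m * E * (m * generic-term)) (ℕₚ.*-monoʳ-≤ (m * E) (ℕₚ.*-monoˡ-≤ (1 * antidiagonal-term) p^d≤m)) ⟩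
        m * E * (m * generic-term) + m * E * (m * (1 * antidiagonal-term))
          ≡⟨ cong₂ _+_ (regroup₁ m E #A) (regroup₂ m E #A) ⟩
        (m * m * (E * E)) * (#A * #A) + (m * m * (E * E * E)) * #A
          ≤⟨ ℕₚ.+-mono-≤ (ℕₚ.*-monoʳ-≤ (m * m * (E * E)) (ℕₚ.*-mono-≤ #A≤E #A≤E)) (ℕₚ.*-monoʳ-≤ (m * m * (E * E * E)) #A≤E) ⟩
        (m * m * (E * E)) * (E * E) + (m * m * (E * E * E)) * E
          ≡⟨ regroup₃ m E ⟩
        2 * (m * m * (E * E * E * E)) ∎
        where
        open ℕₚ.≤-Reasoning
        p^d≤m : p ^ d ≤ m
        p^d≤m = subst (p ^ d ≤_) (sym m≡p^d*p^d) (ℕₚ.m≤m*n (p ^ d) (p ^ d) {{ℕ.>-nonZero (ℕₚ.m^n>0 p d)}})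
        regroup₁ : ∀ m e c → m * e * (m * (c * c * e)) ≡ (m * m * (e * e)) * (c * c)
        regroup₁ = ℕ-solve-∀
        regroup₂ : ∀ m e c → m * e * (m * (1 * (c * (e * e)))) ≡ (m * m * (e * e * e)) * c
        regroup₂ = ℕ-solve-∀
        regroup₃ : ∀ m e → (m * m * (e * e)) * (e * e) + (m * m * (e * e * e)) * e ≡ 2 * (m * m * (e * e * e * e))
        regroup₃ = ℕ-solve-∀

      deviation-bound : 2 ≤ p →
        ℤ.∣ ℤ.+ (count p Q A * p ^ (2 * d)) ℤ.- ℤ.+ (p ^ n * card p A) ∣ ^ 2 * p ^ R ≤ 2 * 2 * (p ^ n) ^ 4 * p ^ (4 * d)
      deviation-bound 2≤p = begin
        ℤ.∣ ℤ.+ (count p Q A * p ^ (2 * d)) ℤ.- ℤ.+ (p ^ n * card p A) ∣ ^ 2 * p ^ R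
          ≡⟨ cong (λ e → e ^ 2 * p ^ R) (trans (∣+m-+n∣≡∣m-n∣ (count p Q A * p ^ (2 * d)) (p ^ n * card p A))
               (cong (λ c → ℕ.∣ c - a ∣) (cong₂ _*_ count≡S𝟘𝟘 (cong (p ^_) (cong (d +_) (ℕₚ.+-identityʳ d)))))) ⟩
        deviation 𝟘 𝟘 ^ 2 * p ^ R
          ≡⟨ cong (λ e → deviation 𝟘 𝟘 * e * p ^ R) (ℕₚ.*-identityʳ (deviation 𝟘 𝟘)) ⟩
        deviation 𝟘 𝟘 * deviation 𝟘 𝟘 * p ^ R
          ≤⟨ ℕₚ.*-monoˡ-≤ (p ^ R) (ℕₚ.≤-trans (term≤sumH d 𝟘 (λ c₂ → deviation 𝟘 c₂ * deviation 𝟘 c₂) (square-ext 𝟘))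
                                              (term≤sumH d 𝟘 (λ c₁ → sumH p d (λ c₂ → deviation c₁ c₂ * deviation c₁ c₂)) row-ext)) ⟩
        variance * p ^ R
          ≤⟨ ℕₚ.≤-trans (variance-bound 2≤p) error-bound ⟩
        2 * (m * m * (E * E * E * E))
          ≤⟨ ℕₚ.m≤m+n _ _ ⟩
        2 * (m * m * (E * E * E * E)) + 2 * (m * m * (E * E * E * E))
          ≡⟨ regroup m E ⟩
        2 * 2 * E ^ 4 * (m * m)
          ≡⟨ cong (2 * 2 * E ^ 4 *_) (sym (trans (cong (p ^_) (four-d d)) (ℕₚ.^-distribˡ-+-* p (d + d) (d + d)))) ⟩
        2 * 2 * (p ^ n) ^ 4 * p ^ (4 * d) ∎
        where
        open ℕₚ.≤-Reasoning
        S-cong : ∀ {c₁ c₁' c₂ c₂' : Vec p d} → c₁ ≗ c₁' → c₂ ≗ c₂' → S c₁ c₂ ≡ S c₁' c₂'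
        S-cong e₁ e₂ = sumH-cong n (λ x → sumH-cong n (λ y → cong (𝟙 p (A y) *_)
          (cong₂ _*_ (cong (𝟙 p) (=ᵛ-cong (λ _ → refl) e₁)) (cong (𝟙 p) (=ᵛ-cong (λ _ → refl) e₂)))))
        square-ext : ∀ c₁ → (λ c₂ → deviation c₁ c₂ * deviation c₁ c₂) Preserves _≗_ ⟶ _≡_
        square-ext c₁ e = cong (λ s → ℕ.∣ s * m - a ∣ * ℕ.∣ s * m - a ∣) (S-cong (λ _ → refl) e)
        row-ext : (λ c₁ → sumH p d (λ c₂ → deviation c₁ c₂ * deviation c₁ c₂)) Preserves _≗_ ⟶ _≡_
        row-ext e = sumH-cong d (λ c₂ → cong (λ s → ℕ.∣ s * m - a ∣ * ℕ.∣ s * m - a ∣) (S-cong e (λ _ → refl)))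
        regroup : ∀ m e → 2 * (m * m * (e * e * e * e)) + 2 * (m * m * (e * e * e * e)) ≡ 2 * 2 * (e * (e * (e * (e * 1)))) * (m * m)
        regroup = ℕ-solve-∀
        four-d : ∀ d → 4 * d ≡ (d + d) + (d + d)
        four-d = ℕ-solve-∀

open import Data.Integer using (+_; _-_; ∣_∣)

lemma7p4 : ∃ λ (C : ℕ) →
    (p : ℕ) .{{_ : NonZero p}} → Prime p → p % 2 ≡ 1 →
    (n d R : ℕ) → (Q : Fin d → QuadPoly p n) → QRankAtLeast p Q R →
    (A : Vec p n → Bool) → (∀ y → A y ≡ true → inZ0 p Q y ≡ true) →
    ∣ (+ (count p Q A * p ^ (2 * d))) - (+ (p ^ n * card p A)) ∣ ^ 2 * p ^ R
      ≤ C * C * (p ^ n) ^ 4 * p ^ (4 * d)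
lemma7p4 = 2 , λ p prime p-odd n d R Q rank A A⊆Z₀ →
  SecondMoment.deviation-bound p prime p-odd Q R rank A A⊆Z₀ (ℕ.nonTrivial⇒n>1 p {{prime⇒nonTrivial prime}})
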